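{- Let $G=(L,R,E)$ be a finite bipartite graph, run Algorithm PivotBiCluster on $G$ with the coloring described in the context. For each tuple $T$ let $q_T=\Pr[X_T]$, let $\mathrm{cost}(T)$ be the number of erroneous pairs of the output clustering that are colored with color $T$, and let $$\beta(T)=\alpha_T\cdot q_T\cdot\min\{|R_{1,2}^T|,|R_2^T|\},\qquad \alpha_T=\min\Big\{1,\frac{|R_{1,2}^T|}{\min\{|R_{1,2}^T|,|R_1^T|\}+\min\{|R_{1,2}^T|,|R_2^T|\}}\Big\}$$ (with $\beta(T)=0$ when $R_{1,2}^T=\emptyset$). Then for every tuple $T$, with conjugate tuple $\bar T$, $$q_T\cdot\mathbb{E}[\mathrm{cost}(T)\mid X_T]+q_{\bar T}\cdot\mathbb{E}[\mathrm{cost}(\bar T)\mid X_{\bar T}]\le 4\big(\beta(T)+\beta(\bar T)\big),$$ where a term $q\cdot\mathbb{E}[\cdot\mid\cdot]$ with $q=0$ is taken to be $0$.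
   Context: Input: bipartite graph $G=(L,R,E)$, $E\subseteq L\times R$. For a clustering of $L\cup R$, a pair $(\ell,r)\in L\times R$ is erroneous if either $(\ell,r)\in E$ but $\ell,r$ are in different clusters, or $(\ell,r)\notin E$ but $\ell,r$ are in the same cluster. Algorithm PivotBiCluster: $N(\ell)$ denotes the set of right nodes adjacent to $\ell\in L$ not yet removed. While left nodes remain: choose a remaining left node $\ell_1$ uniformly at random (the "left center") and form $C=\{\ell_1\}\cup N(\ell_1)$. For each other remaining left node $\ell_2$, with neighborhoods at the moment $\ell_1$ was chosen, let $R_1=N(\ell_1)\setminus N(\ell_2)$, $R_{1,2}=N(\ell_1)\cap N(\ell_2)$, $R_2=N(\ell_2)\setminus N(\ell_1)$; with probability $\min\{|R_{1,2}|/|R_2|,1\}$ (taken as $1$ if $|R_2|=0$): if $|R_{1,2}|\ge|R_1|$ append $\ell_2$ to $C$, else make $\ell_2$ a singleton; otherwise do nothing with $\ell_2$. Remove $C$ and the new singletons and repeat. A tuple is $T=(\ell_1^T,\ell_2^T,R_1^T,R_{1,2}^T,R_2^T)$ with $\ell_1^T\neq\ell_2^T\in L$, and (with $N$ the neighborhood in $G$) $R_1^T\subseteq N(\ell_1^T)\setminus N(\ell_2^T)$, $R_2^T\subseteq N(\ell_2^T)\setminus N(\ell_1^T)$, $R_{1,2}^T\subseteq N(\ell_1^T)\cap N(\ell_2^T)$. Its conjugate is $\bar T=(\ell_2^T,\ell_1^T,R_2^T,R_{1,2}^T,R_1^T)$. The bad event $X_T$ happens if during the execution $\ell_1^T$ is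 chosen as left center while $\ell_2^T$ is still in the graph and at that moment the current neighborhoods satisfy $R_1^T=N(\ell_1^T)\setminus N(\ell_2^T)$, $R_{1,2}^T=N(\ell_1^T)\cap N(\ell_2^T)$, $R_2^T=N(\ell_2^T)\setminus N(\ell_1^T)$. Coloring: if $X_T$ happens, color with color $T$ all pairs $(\ell_2^T,r)$ with $r\in R_1^T\cup R_{1,2}^T$, and also all pairs $(\ell_2^T,r)$ with $r\in R_2^T$ but only if in this phase $\ell_2^T$ was appended to $\ell_1^T$'s cluster or made a singleton. -}

module Defs where

open import Data.Bool using (Bool; true; false; if_then_else_; _∧_; _∨_; not; _xor_)
open import Data.Nat as ℕ using (ℕ; zero; suc)
open import Data.Fin using (Fin; _≟_)
open import Data.Fin.Subset using (Subset; ⊤; ⊥; _∈_; _⊆_; _∩_; _∪_; _─_; ∁; ∣_∣)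
open import Data.Vec using (lookup)
open import Data.List using (List; []; _∷_; map; concatMap; foldr; filterᵇ; length)
open import Data.Bool.ListAction using (any)
open import Data.List.Base using (allFin)
open import Data.Product using (_×_; _,_)
open import Data.Integer using (+_)
open import Data.Rational using (ℚ; 0ℚ; 1ℚ; _+_; _*_; _-_; _/_; _⊓_)
open import Relation.Nullary using (¬_; does)
open import Relation.Binary.PropositionalEquality using (_≡_)

-- Finite rational-valued distributions (explicit enumeration)

Dist : Set → Set
Dist A = List (ℚ × A)

return : {A : Set} → A → Dist A
return a = (1ℚ , a) ∷ []

_>>=_ : {A B : Set} → Dist A → (A → Dist B) → Dist B
d >>= f = concatMap (λ { (p , a) → map (λ { (q , b) → (p * q , b) }) (f a) }) d

bernoulli : {A : Set} → ℚ → A → A → Dist A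
bernoulli p a b = (p , a) ∷ (1ℚ - p , b) ∷ []

-- uniform choice from a list (empty list gives empty distribution)
uniform : {A : Set} → List A → Dist A
uniform xs with length xs
... | zero  = []
... | suc k = map (λ x → (+ 1 / suc k , x)) xs

𝔼 : {A : Set} → Dist A → (A → ℚ) → ℚ
𝔼 d f = foldr (λ { (p , a) acc → p * f a + acc }) 0ℚ d

-- ℕ-ratio a / b as a rational, for b ≢ 0 (callers treat b = 0 separately)
frac : ℕ → ℕ → ℚ
frac a zero    = 0ℚ
frac a (suc b) = + a / suc b

fromℕ : ℕ → ℚ
fromℕ a = + a / 1

boolℚ : Bool → ℚ
boolℚ true  = 1ℚ
boolℚ false = 0ℚ

-- Bipartite graphs: L = Fin m, R = Fin n, E given by adjacency rows.

Graph : ℕ → ℕ → Set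
Graph m n = Fin m → Subset n

members : {k : ℕ} → Subset k → List (Fin k)
members s = filterᵇ (lookup s) (allFin _)

_∈ᵇ_ : {k : ℕ} → Fin k → Subset k → Bool
i ∈ᵇ s = lookup s i

-- decision taken for a left node ℓ₂ in a phase
data Action : Set where
  append single nothing : Action

isNothing : Action → Bool
isNothing nothing = true
isNothing _       = false

isAppend : Action → Bool
isAppend append = true
isAppend _      = false

record Phase (m n : ℕ) : Set where
  constructor phase
  field
    remL    : Subset m        -- remaining left nodes when the center is chosen
    remR    : Subset n        -- remaining right nodes when the center is chosen
    center  : Fin m
    decide  : Fin m → Action  -- decision for every other left node (nothing if not remaining)
open Phase public

Trace : ℕ → ℕ → Set
Trace m n = List (Phase m n)

module Algorithm {m n : ℕ} (G : Graph m n) where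

  Nb : Subset n → Fin m → Subset n
  Nb rR ℓ = G ℓ ∩ rR

  decision : Subset n → Fin m → Fin m → Dist Action
  decision rR ℓ₁ ℓ₂ =
    let N1  = Nb rR ℓ₁
        N2  = Nb rR ℓ₂
        r1  = ∣ N1 ─ N2 ∣
        r12 = ∣ N1 ∩ N2 ∣
        r2  = ∣ N2 ─ N1 ∣
        p   = prob r12 r2
        act = if r1 ℕ.≤ᵇ r12 then append else single
    in bernoulli p act nothing
    where
    prob : ℕ → ℕ → ℚ
    prob r12 zero     = 1ℚ
    prob r12 (suc k)  = frac r12 (suc k) ⊓ 1ℚ

  update : (Fin m → Action) → Fin m → Action → Fin m → Action
  update f ℓ a x = if does (x ≟ ℓ) then a else f x

  decisions : Subset n → Fin m → List (Fin m) → Dist (Fin m → Action)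
  decisions rR ℓ₁ []        = return (λ _ → nothing)
  decisions rR ℓ₁ (ℓ₂ ∷ ls) =
    decisions rR ℓ₁ ls >>= λ f →
    decision rR ℓ₁ ℓ₂ >>= λ a →
    return (update f ℓ₂ a)

  removedL : (Fin m → Action) → Subset m → Fin m → Subset m
  removedL f rL ℓ₁ = Data.Vec.tabulate (λ x →
    does (x ≟ ℓ₁) ∨ (lookup rL x ∧ not (isNothing (f x))))
    where import Data.Vec

  -- fuel = bound on the number of phases (each phase removes its center)
  run : ℕ → Subset m → Subset n → Dist (Trace m n)
  run zero     rL rR = return []
  run (suc k)  rL rR with members rL
  ... | []  = return []
  ... | ls  =
    uniform ls >>= λ ℓ₁ →
    decisions rR ℓ₁ (filterᵇ (λ x → not (does (x ≟ ℓ₁))) ls) >>= λ f →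
    run k (rL ─ removedL f rL ℓ₁) (rR ─ Nb rR ℓ₁) >>= λ tr →
    return (phase rL rR ℓ₁ f ∷ tr)

  pivotBiCluster : Dist (Trace m n)
  pivotBiCluster = run m ⊤ ⊤

  -- ℓ and r end in the same cluster: in some phase ℓ is the center or is
  -- appended, and r is in the current neighborhood of the center.
  sameCluster : Trace m n → Fin m → Fin n → Bool
  sameCluster tr ℓ r = any (λ ph →
      (does (ℓ ≟ center ph) ∨ isAppend (decide ph ℓ))
      ∧ (r ∈ᵇ Nb (remR ph) (center ph))) tr

  erroneous : Trace m n → Fin m → Fin n → Bool
  erroneous tr ℓ r = (r ∈ᵇ G ℓ) xor sameCluster tr ℓ r

record Tuple (m n : ℕ) : Set where
  constructor tuple
  field
    ℓ₁ ℓ₂       : Fin m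
    R₁ R₁₂ R₂   : Subset n
open Tuple public

conj : {m n : ℕ} → Tuple m n → Tuple m n
conj (tuple a b R1 R12 R2) = tuple b a R2 R12 R1

IsTuple : {m n : ℕ} → Graph m n → Tuple m n → Set
IsTuple G T =
  ¬ (ℓ₁ T ≡ ℓ₂ T)
  × R₁ T ⊆ (G (ℓ₁ T) ─ G (ℓ₂ T))
  × R₂ T ⊆ (G (ℓ₂ T) ─ G (ℓ₁ T))
  × R₁₂ T ⊆ (G (ℓ₁ T) ∩ G (ℓ₂ T))

module Analysis {m n : ℕ} (G : Graph m n) where
  open Algorithm G

  subsetEqᵇ : Subset n → Subset n → Bool
  subsetEqᵇ a b = does (VecP.≡-dec Bool._≟_ a b)
    where
    import Data.Vec.Properties as VecP
    import Data.Bool as Bool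

  XᵀAt : Tuple m n → Phase m n → Bool
  XᵀAt T ph =
    let N1 = Nb (remR ph) (ℓ₁ T)
        N2 = Nb (remR ph) (ℓ₂ T)
    in does (center ph ≟ ℓ₁ T) ∧ (ℓ₂ T ∈ᵇ remL ph)
       ∧ subsetEqᵇ (R₁ T) (N1 ─ N2)
       ∧ subsetEqᵇ (R₁₂ T) (N1 ∩ N2)
       ∧ subsetEqᵇ (R₂ T) (N2 ─ N1)

  X : Tuple m n → Trace m n → Bool
  X T tr = any (XᵀAt T) tr

  colored : Tuple m n → Trace m n → Fin m → Fin n → Bool
  colored T tr ℓ r = any (λ ph → XᵀAt T ph ∧ does (ℓ ≟ ℓ₂ T)
      ∧ ((r ∈ᵇ (R₁ T ∪ R₁₂ T))
         ∨ ((r ∈ᵇ R₂ T) ∧ not (isNothing (decide ph (ℓ₂ T)))))) tr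

  count : {A : Set} → List A → (A → Bool) → ℕ
  count xs p = length (filterᵇ p xs)

  cost : Tuple m n → Trace m n → ℕ
  cost T tr = sum (map (λ ℓ → count (allFin n) λ r →
                erroneous tr ℓ r ∧ colored T tr ℓ r) (allFin m))
    where open import Data.Nat.ListAction using (sum)

  q : Tuple m n → ℚ
  q T = 𝔼 pivotBiCluster (λ tr → boolℚ (X T tr))

  -- q_T · E[cost(T) | X_T], taken as 0 when q_T = 0; i.e. E[cost(T) · 1_{X_T}]
  qE : Tuple m n → ℚ
  qE T = 𝔼 pivotBiCluster (λ tr → fromℕ (cost T tr) * boolℚ (X T tr))

  α : Tuple m n → ℚ
  α T with ∣ R₁₂ T ∣ ℕ.⊓ ∣ R₁ T ∣ ℕ.+ ∣ R₁₂ T ∣ ℕ.⊓ ∣ R₂ T ∣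
  ... | zero  = 1ℚ
  ... | suc d = 1ℚ ⊓ frac ∣ R₁₂ T ∣ (suc d)

  β : Tuple m n → ℚ
  β T with ∣ R₁₂ T ∣
  ... | zero  = 0ℚ
  ... | suc _ = α T * q T * fromℕ (∣ R₁₂ T ∣ ℕ.⊓ ∣ R₂ T ∣)

module Submission where

-- Fix T with conjugate T̄ (only ℓ₁ ≠ ℓ₂ is needed).  X_T needs ℓ₁ as centre
-- with ℓ₂ present, X_T̄ the reverse, and a centre is removed; so along a run
-- at most one of the two events happens, in a single phase.  In that phase
-- the decision d taken for the other node confines the erroneous pairs of the
-- hit colour to a set of size g(d) (errBound).  Write firstHit A B for the
-- value of A (resp. B) at the phase where X_T (resp. X_T̄) happens, 0 if none,
-- and K = β / q (βRate).  The proof has three steps: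
--   (1) pointwise, cost(T)·1[X_T] + cost(T̄)·1[X_T̄] ≤ firstHit g_T g_T̄;
--   (2) E[firstHit (4K_T − g_T) (4K_T̄ − g_T̄)] ≥ 0 by induction over the run:
--       the centres ℓ₁ and ℓ₂ are equally likely and trigger X_T resp. X_T̄
--       in the same states, where the numeric pair inequality (pairBound)
--       gives E[g_T] + E[g_T̄] ≤ 4 (K_T + K_T̄);
--   (3) E[firstHit 4K_T 4K_T̄] ≤ 4 K_T q_T + 4 K_T̄ q_T̄ = 4 (β(T) + β(T̄)).

open import Defs
open import Data.Nat using (ℕ)
open import Data.Integer using (+_)
open import Data.Rational using (_≤_; _+_; _*_; _/_)

open import Data.Nat as ℕ using (zero; suc; z≤n; s≤s; _≤ᵇ_)
import Data.Nat.Properties as ℕP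
import Data.Integer as ℤ
import Data.Integer.Properties as ℤP
open import Data.Rational using (ℚ; 0ℚ; 1ℚ; _-_; -_; _⊓_; toℚᵘ; nonNegative)
open import Data.Rational.Properties hiding (_≟_)
import Data.Rational.Unnormalised as ℚᵘ
import Data.Rational.Unnormalised.Properties as ℚᵘP
open import Data.Rational.Solver using (module +-*-Solver)
open import Data.Bool as Bool using (Bool; true; false; if_then_else_; T; T?; _∧_; _∨_; not; _xor_)
open import Data.Bool.Properties using (∧-zeroʳ; ∧-identityʳ; ∨-zeroʳ; ∨-identityʳ; ∨-assoc; T-≡)
open import Data.Bool.ListAction using (any)
open import Data.Nat.ListAction using (sum)
open import Data.Fin using (Fin; _≟_)
import Data.Fin as Fin
import Data.Fin.Properties as FinP
open import Data.Fin.Subset using (Subset; _─_; _∩_; _∪_; ∣_∣; ⊤)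
open import Data.Fin.Subset.Properties using (∩-comm)
open import Data.Vec using (lookup) renaming ([] to []ᵥ; _∷_ to _∷ᵥ_)
import Data.Vec.Properties as VecP
open import Data.List using (List; []; _∷_; map; filterᵇ; length; _++_; allFin; tabulate)
import Data.List.Properties as ListP
open import Data.List.Relation.Unary.All as All using (All; []; _∷_)
import Data.List.Relation.Unary.All.Properties as AllP
open import Data.List.Relation.Unary.Any using (here; there)
open import Data.List.Membership.Propositional using (_∈_; _∉_)
import Data.List.Membership.Propositional.Properties as MemP
open import Data.List.Relation.Unary.Unique.Propositional using (Unique)
import Data.List.Relation.Unary.Unique.Propositional.Properties as UniqueP
open import Data.List.Relation.Unary.AllPairs using (_∷_)
open import Data.Product using (_×_; _,_; proj₁; proj₂)
open import Data.Sum using (inj₁; inj₂)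
open import Data.Empty using (⊥-elim)
open import Data.Unit using (tt) renaming (⊤ to Unit)
open import Function using (_∘_; id; Equivalence)
open import Relation.Nullary using (¬_; yes; no; does)
open import Relation.Binary.Definitions using (DecidableEquality)
open import Relation.Binary.PropositionalEquality
open +-*-Solver using (solve; _:=_; _:+_; _:*_; _:-_; con)

-- Expectations of finite distributions

𝔼-++ : {A : Set} (xs ys : Dist A) (f : A → ℚ) → 𝔼 (xs ++ ys) f ≡ 𝔼 xs f + 𝔼 ys f
𝔼-++ []             ys f = sym (+-identityˡ _)
𝔼-++ ((p , a) ∷ xs) ys f =
  trans (cong (λ z → p * f a + z) (𝔼-++ xs ys f)) (sym (+-assoc (p * f a) (𝔼 xs f) (𝔼 ys f)))

-- Multiplying every weight by p multiplies the expectation by p.  The map h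
-- is abstract because `_>>=_` uses its own (pattern-lambda) reweighting.
𝔼-reweight : {B : Set} (p : ℚ) (h : ℚ × B → ℚ × B) → (∀ q b → h (q , b) ≡ (p * q , b)) →
  (ys : Dist B) (f : B → ℚ) → 𝔼 (map h ys) f ≡ p * 𝔼 ys f
𝔼-reweight p h h-def []             f = sym (*-zeroʳ p)
𝔼-reweight p h h-def ((q , b) ∷ ys) f rewrite h-def q b =
  trans (cong (λ z → (p * q) * f b + z) (𝔼-reweight p h h-def ys f))
    (solve 4 (λ p q x e → (p :* q) :* x :+ p :* e := p :* (q :* x :+ e)) refl p q (f b) (𝔼 ys f))

𝔼-bind : {A B : Set} (d : Dist A) (g : A → Dist B) (f : B → ℚ) →
  𝔼 (d >>= g) f ≡ 𝔼 d (λ a → 𝔼 (g a) f)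
𝔼-bind []            g f = refl
𝔼-bind ((p , a) ∷ d) g f =
  trans (𝔼-++ (map (λ { (q , b) → (p * q , b) }) (g a)) (d >>= g) f)
    (cong₂ _+_ (𝔼-reweight p (λ { (q , b) → (p * q , b) }) (λ q b → refl) (g a) f) (𝔼-bind d g f))

𝔼-return : {A : Set} (a : A) (f : A → ℚ) → 𝔼 (return a) f ≡ f a
𝔼-return a f = trans (+-identityʳ _) (*-identityˡ _)

𝔼-cong : {A : Set} (d : Dist A) {f g : A → ℚ} → (∀ a → f a ≡ g a) → 𝔼 d f ≡ 𝔼 d g
𝔼-cong []            f≗g = refl
𝔼-cong ((p , a) ∷ d) f≗g = cong₂ _+_ (cong (p *_) (f≗g a)) (𝔼-cong d f≗g)

𝔼-+ : {A : Set} (d : Dist A) (f g : A → ℚ) → 𝔼 d (λ a → f a + g a) ≡ 𝔼 d f + 𝔼 d g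
𝔼-+ []            f g = refl
𝔼-+ ((p , a) ∷ d) f g = trans (cong (λ z → p * (f a + g a) + z) (𝔼-+ d f g))
  (solve 5 (λ p x y e₁ e₂ → p :* (x :+ y) :+ (e₁ :+ e₂) := (p :* x :+ e₁) :+ (p :* y :+ e₂))
     refl p (f a) (g a) (𝔼 d f) (𝔼 d g))

𝔼-*ˡ : {A : Set} (d : Dist A) (c : ℚ) (f : A → ℚ) → 𝔼 d (λ a → c * f a) ≡ c * 𝔼 d f
𝔼-*ˡ []            c f = sym (*-zeroʳ c)
𝔼-*ˡ ((p , a) ∷ d) c f = trans (cong (λ z → p * (c * f a) + z) (𝔼-*ˡ d c f))
  (solve 4 (λ p c x e → p :* (c :* x) :+ c :* e := c :* (p :* x :+ e)) refl p c (f a) (𝔼 d f))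

𝔼-neg : {A : Set} (d : Dist A) (f : A → ℚ) → 𝔼 d (λ a → - f a) ≡ - 𝔼 d f
𝔼-neg []            f = refl
𝔼-neg ((p , a) ∷ d) f = trans (cong (λ z → p * - f a + z) (𝔼-neg d f))
  (solve 3 (λ p x e → p :* (:- x) :+ (:- e) := :- (p :* x :+ e)) refl p (f a) (𝔼 d f))
  where open +-*-Solver using (:-_)

Supported : {A : Set} → (A → Set) → Dist A → Set
Supported P d = All (λ x → 0ℚ ≤ proj₁ x × P (proj₂ x)) d

Supported-++ : {A : Set} {P : A → Set} (xs ys : Dist A) →
  Supported P xs → Supported P ys → Supported P (xs ++ ys)
Supported-++ []       ys sx       sy = sy
Supported-++ (x ∷ xs) ys (s ∷ sx) sy = s ∷ Supported-++ xs ys sx sy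

*-nonneg : ∀ {x y} → 0ℚ ≤ x → 0ℚ ≤ y → 0ℚ ≤ x * y
*-nonneg {x} {y} 0≤x 0≤y =
  nonNegative⁻¹ (x * y) ⦃ nonNeg*nonNeg⇒nonNeg x ⦃ nonNegative 0≤x ⦄ y ⦃ nonNegative 0≤y ⦄ ⦄

+-nonneg : ∀ {x y} → 0ℚ ≤ x → 0ℚ ≤ y → 0ℚ ≤ x + y
+-nonneg 0≤x 0≤y = +-mono-≤ 0≤x 0≤y

Supported-reweight : {B : Set} {P : B → Set} (p : ℚ) → 0ℚ ≤ p →
  (h : ℚ × B → ℚ × B) → (∀ q b → h (q , b) ≡ (p * q , b)) →
  (ys : Dist B) → Supported P ys → Supported P (map h ys)
Supported-reweight p 0≤p h h-def []             []              = []
Supported-reweight p 0≤p h h-def ((q , b) ∷ ys) ((0≤q , Pb) ∷ s) rewrite h-def q b =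
  (*-nonneg 0≤p 0≤q , Pb) ∷ Supported-reweight p 0≤p h h-def ys s

Supported-bind : {A B : Set} {P : A → Set} {Q : B → Set} (d : Dist A) (g : A → Dist B) →
  Supported P d → (∀ a → P a → Supported Q (g a)) → Supported Q (d >>= g)
Supported-bind []            g []              sg = []
Supported-bind ((p , a) ∷ d) g ((0≤p , Pa) ∷ s) sg =
  Supported-++ (map (λ { (q , b) → (p * q , b) }) (g a)) (d >>= g)
    (Supported-reweight p 0≤p (λ { (q , b) → (p * q , b) }) (λ q b → refl) (g a) (sg a Pa))
    (Supported-bind d g s sg)

0≤1 : 0ℚ ≤ 1ℚ
0≤1 = ≤ᵇ⇒≤ tt

Supported-return : {A : Set} {P : A → Set} (a : A) → P a → Supported P (return a)
Supported-return a Pa = (0≤1 , Pa) ∷ []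

𝔼-mono : {A : Set} {P : A → Set} (d : Dist A) {f g : A → ℚ} → Supported P d →
  (∀ a → P a → f a ≤ g a) → 𝔼 d f ≤ 𝔼 d g
𝔼-mono []            []              f≤g = ≤-refl
𝔼-mono ((p , a) ∷ d) ((0≤p , Pa) ∷ s) f≤g =
  +-mono-≤ (*-monoˡ-≤-nonNeg p ⦃ nonNegative 0≤p ⦄ (f≤g a Pa)) (𝔼-mono d s f≤g)

𝔼-nonneg : {A : Set} {P : A → Set} (d : Dist A) {f : A → ℚ} → Supported P d →
  (∀ a → P a → 0ℚ ≤ f a) → 0ℚ ≤ 𝔼 d f
𝔼-nonneg d s 0≤f = ≤-trans (≤-reflexive (sym (𝔼-zero d))) (𝔼-mono d s 0≤f)
  where
  𝔼-zero : {A : Set} (d : Dist A) → 𝔼 d (λ _ → 0ℚ) ≡ 0ℚ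
  𝔼-zero []            = refl
  𝔼-zero ((p , a) ∷ d) = trans (cong₂ _+_ (*-zeroʳ p) (𝔼-zero d)) refl

Mass1 : {A : Set} → Dist A → Set
Mass1 d = 𝔼 d (λ _ → 1ℚ) ≡ 1ℚ

Mass1-bind : {A B : Set} (d : Dist A) (g : A → Dist B) → Mass1 d → (∀ a → Mass1 (g a)) →
  Mass1 (d >>= g)
Mass1-bind d g md mg = trans (𝔼-bind d g _) (trans (𝔼-cong d mg) md)

𝔼-const : {A : Set} (d : Dist A) (c : ℚ) → Mass1 d → 𝔼 d (λ _ → c) ≡ c
𝔼-const d c md = begin
  𝔼 d (λ _ → c)        ≡⟨ 𝔼-cong d (λ _ → sym (*-identityʳ c)) ⟩
  𝔼 d (λ _ → c * 1ℚ)   ≡⟨ 𝔼-*ˡ d c (λ _ → 1ℚ) ⟩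
  c * 𝔼 d (λ _ → 1ℚ)   ≡⟨ cong (c *_) md ⟩
  c * 1ℚ               ≡⟨ *-identityʳ c ⟩
  c                    ∎
  where open ≡-Reasoning

𝔼-const-sub : {A : Set} (d : Dist A) (c : ℚ) (f : A → ℚ) → Mass1 d →
  𝔼 d (λ a → c - f a) ≡ c - 𝔼 d f
𝔼-const-sub d c f md =
  trans (𝔼-+ d (λ _ → c) (λ a → - f a)) (cong₂ _+_ (𝔼-const d c md) (𝔼-neg d f))

𝔼-bernoulli : {A : Set} (p : ℚ) (x y : A) (f : A → ℚ) →
  𝔼 (bernoulli p x y) f ≡ p * f x + (1ℚ - p) * f y
𝔼-bernoulli p x y f = cong (λ z → p * f x + z) (+-identityʳ _)

Mass1-bernoulli : {A : Set} (p : ℚ) (x y : A) → Mass1 (bernoulli p x y)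
Mass1-bernoulli p x y = trans (𝔼-bernoulli p x y (λ _ → 1ℚ))
  (solve 1 (λ p → p :* con 1ℚ :+ (con 1ℚ :- p) :* con 1ℚ := con 1ℚ) refl p)

1-p-nonneg : ∀ {p} → p ≤ 1ℚ → 0ℚ ≤ 1ℚ - p
1-p-nonneg {p} p≤1 = ≤-trans (≤-reflexive (sym (+-inverseʳ p))) (+-monoˡ-≤ (- p) p≤1)

Supported-bernoulli : {A : Set} {p : ℚ} (x y : A) → 0ℚ ≤ p → p ≤ 1ℚ →
  Supported (λ _ → Unit) (bernoulli p x y)
Supported-bernoulli x y 0≤p p≤1 = (0≤p , tt) ∷ (1-p-nonneg p≤1 , tt) ∷ []

-- fromℕ and frac compute through their unnormalised representatives.
toℚᵘ-ratio : ∀ a k → toℚᵘ (+ a / suc k) ℚᵘ.≃ ℚᵘ.mkℚᵘ (+ a) k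
toℚᵘ-ratio a k = toℚᵘ-fromℚᵘ (ℚᵘ.mkℚᵘ (+ a) k)

fromℕ-suc : ∀ a → fromℕ (suc a) ≡ 1ℚ + fromℕ a
fromℕ-suc a = toℚᵘ-injective (ℚᵘP.≃-trans (toℚᵘ-ratio (suc a) 0) (ℚᵘP.≃-trans unnormalised
  (ℚᵘP.≃-sym (ℚᵘP.≃-trans (toℚᵘ-homo-+ 1ℚ (fromℕ a)) (ℚᵘP.+-congʳ (toℚᵘ 1ℚ) (toℚᵘ-ratio a 0))))))
  where
  unnormalised : ℚᵘ.mkℚᵘ (+ suc a) 0 ℚᵘ.≃ (toℚᵘ 1ℚ ℚᵘ.+ ℚᵘ.mkℚᵘ (+ a) 0)
  unnormalised = ℚᵘ.*≡* (trans (ℤP.*-identityʳ _)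
    (sym (trans (ℤP.*-identityʳ _) (cong (λ z → + 1 ℤ.+ z) (ℤP.*-identityʳ (+ a))))))

frac-cancel : ∀ c k → frac c (suc k) * fromℕ (suc k) ≡ fromℕ c
frac-cancel c k = toℚᵘ-injective (ℚᵘP.≃-trans (toℚᵘ-homo-* (frac c (suc k)) (fromℕ (suc k)))
  (ℚᵘP.≃-trans (ℚᵘP.*-cong (toℚᵘ-ratio c k) (toℚᵘ-ratio (suc k) 0))
    (ℚᵘP.≃-trans unnormalised (ℚᵘP.≃-sym (toℚᵘ-ratio c 0)))))
  where
  unnormalised : (ℚᵘ.mkℚᵘ (+ c) k ℚᵘ.* ℚᵘ.mkℚᵘ (+ suc k) 0) ℚᵘ.≃ ℚᵘ.mkℚᵘ (+ c) 0
  unnormalised = ℚᵘ.*≡* (trans (ℤP.*-identityʳ _)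
    (cong (+ c ℤ.*_) (cong +_ (sym (ℕP.*-identityʳ (suc k))))))

fromℕ-+ : ∀ a b → fromℕ (a ℕ.+ b) ≡ fromℕ a + fromℕ b
fromℕ-+ zero    b = sym (+-identityˡ _)
fromℕ-+ (suc a) b = begin
  fromℕ (suc (a ℕ.+ b))          ≡⟨ fromℕ-suc (a ℕ.+ b) ⟩
  1ℚ + fromℕ (a ℕ.+ b)           ≡⟨ cong (λ z → 1ℚ + z) (fromℕ-+ a b) ⟩
  1ℚ + (fromℕ a + fromℕ b)       ≡⟨ sym (+-assoc 1ℚ (fromℕ a) (fromℕ b)) ⟩
  (1ℚ + fromℕ a) + fromℕ b       ≡⟨ cong (_+ fromℕ b) (sym (fromℕ-suc a)) ⟩
  fromℕ (suc a) + fromℕ b        ∎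
  where open ≡-Reasoning

≤-+-nonneg : ∀ x {y} → 0ℚ ≤ y → x ≤ x + y
≤-+-nonneg x 0≤y = ≤-trans (≤-reflexive (sym (+-identityʳ x))) (+-monoʳ-≤ x 0≤y)

fromℕ-nonneg : ∀ a → 0ℚ ≤ fromℕ a
fromℕ-nonneg a = nonNegative⁻¹ _ ⦃ normalize-nonNeg a 1 ⦄

fromℕ-mono : ∀ {a b} → a ℕ.≤ b → fromℕ a ≤ fromℕ b
fromℕ-mono {a} a≤b with ℕP.m≤n⇒∃[o]m+o≡n a≤b
... | d , refl = ≤-trans (≤-+-nonneg (fromℕ a) (fromℕ-nonneg d)) (≤-reflexive (sym (fromℕ-+ a d)))

frac-nonneg : ∀ c b → 0ℚ ≤ frac c b
frac-nonneg c zero    = ≤-refl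
frac-nonneg c (suc k) = nonNegative⁻¹ _ ⦃ normalize-nonNeg c (suc k) ⦄

frac≥1 : ∀ c k → suc k ℕ.≤ c → 1ℚ ≤ frac c (suc k)
frac≥1 c k 1+k≤c = *-cancelʳ-≤-pos (fromℕ (suc k)) ⦃ normalize-pos (suc k) 1 ⦄
  (≤-trans (≤-reflexive (*-identityˡ _))
    (≤-trans (fromℕ-mono 1+k≤c) (≤-reflexive (sym (frac-cancel c k)))))

frac≤1 : ∀ c k → c ℕ.≤ suc k → frac c (suc k) ≤ 1ℚ
frac≤1 c k c≤1+k = *-cancelʳ-≤-pos (fromℕ (suc k)) ⦃ normalize-pos (suc k) 1 ⦄
  (≤-trans (≤-reflexive (frac-cancel c k))
    (≤-trans (fromℕ-mono c≤1+k) (≤-reflexive (sym (*-identityˡ _)))))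

sumℚ : {A : Set} → (A → ℚ) → List A → ℚ
sumℚ h []       = 0ℚ
sumℚ h (x ∷ xs) = h x + sumℚ h xs

𝔼-equalWeights : {A : Set} (w : ℚ) (xs : List A) (f : A → ℚ) →
  𝔼 (map (λ y → (w , y)) xs) f ≡ w * sumℚ f xs
𝔼-equalWeights w []       f = sym (*-zeroʳ w)
𝔼-equalWeights w (x ∷ xs) f =
  trans (cong (λ z → w * f x + z) (𝔼-equalWeights w xs f)) (sym (*-distribˡ-+ w (f x) (sumℚ f xs)))

Mass1-uniform : {A : Set} (x : A) (xs : List A) → Mass1 (uniform (x ∷ xs))
Mass1-uniform x xs = begin
  𝔼 (uniform (x ∷ xs)) (λ _ → 1ℚ)        ≡⟨ 𝔼-equalWeights w (x ∷ xs) (λ _ → 1ℚ) ⟩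
  w * sumℚ (λ _ → 1ℚ) (x ∷ xs)           ≡⟨ cong (w *_) (sum-ones (x ∷ xs)) ⟩
  w * fromℕ (suc (length xs))            ≡⟨ frac-cancel 1 (length xs) ⟩
  1ℚ                                     ∎
  where
  open ≡-Reasoning
  w = frac 1 (suc (length xs))
  sum-ones : {A : Set} (ys : List A) → sumℚ (λ _ → 1ℚ) ys ≡ fromℕ (length ys)
  sum-ones []       = refl
  sum-ones (y ∷ ys) = trans (cong (λ z → 1ℚ + z) (sum-ones ys)) (sym (fromℕ-suc (length ys)))

Supported-uniform : {A : Set} {P : A → Set} (x : A) (xs : List A) → All P (x ∷ xs) →
  Supported P (uniform (x ∷ xs))
Supported-uniform {P = P} x xs = equalWeights (x ∷ xs)
  where
  w = frac 1 (suc (length xs))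
  equalWeights : (ys : List _) → All P ys → Supported P (map (λ y → (w , y)) ys)
  equalWeights []       []         = []
  equalWeights (y ∷ ys) (Py ∷ Pys) = (frac-nonneg 1 (suc (length xs)) , Py) ∷ equalWeights ys Pys

sumℚ-nonneg : {A : Set} (h : A → ℚ) (xs : List A) → (∀ x → x ∈ xs → 0ℚ ≤ h x) → 0ℚ ≤ sumℚ h xs
sumℚ-nonneg h []       h≥0 = ≤-refl
sumℚ-nonneg h (x ∷ xs) h≥0 = +-nonneg (h≥0 x (here refl)) (sumℚ-nonneg h xs (λ z z∈ → h≥0 z (there z∈)))

term≤sumℚ : {A : Set} (h : A → ℚ) (xs : List A) (y : A) → Unique xs → y ∈ xs →
  (∀ x → x ∈ xs → ¬ x ≡ y → 0ℚ ≤ h x) → h y ≤ sumℚ h xs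
term≤sumℚ h (x ∷ xs) y (x∉xs ∷ _) (here refl) others≥0 =
  ≤-+-nonneg (h y) (sumℚ-nonneg h xs (λ z z∈ → others≥0 z (there z∈) (λ z≡y → All.lookup x∉xs z∈ (sym z≡y))))
term≤sumℚ h (x ∷ xs) y (x∉xs ∷ u) (there y∈) others≥0 = ≤-trans
  (term≤sumℚ h xs y u y∈ (λ z z∈ → others≥0 z (there z∈)))
  (≤-trans (≤-reflexive (sym (+-identityˡ _)))
    (+-monoˡ-≤ (sumℚ h xs) (others≥0 x (here refl) (All.lookup x∉xs y∈))))

module _ {A : Set} (_≟A_ : DecidableEquality A) where
  open import Data.List.Membership.DecPropositional _≟A_ using (_∈?_)

  private
    ∉-∷ : {x y : A} {xs : List A} → ¬ y ≡ x → y ∉ xs → y ∉ (x ∷ xs)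
    ∉-∷ y≢x y∉xs (here y≡x) = y≢x y≡x
    ∉-∷ y≢x y∉xs (there y∈) = y∉xs y∈

  sumℚ-nonneg-pair : (h : A → ℚ) (xs : List A) (y₁ y₂ : A) → Unique xs → ¬ y₁ ≡ y₂ →
    (∀ x → x ∈ xs → ¬ x ≡ y₁ → ¬ x ≡ y₂ → 0ℚ ≤ h x) →
    (y₁ ∈ xs → y₂ ∈ xs → 0ℚ ≤ h y₁ + h y₂) →
    (y₁ ∈ xs → y₂ ∉ xs → 0ℚ ≤ h y₁) →
    (y₂ ∈ xs → y₁ ∉ xs → 0ℚ ≤ h y₂) → 0ℚ ≤ sumℚ h xs
  sumℚ-nonneg-pair h []       y₁ y₂ u y₁≢y₂ rest both only₁ only₂ = ≤-refl
  sumℚ-nonneg-pair h (x ∷ xs) y₁ y₂ (x∉xs ∷ u) y₁≢y₂ rest both only₁ only₂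
    with x ≟A y₁ | x ≟A y₂
  ... | yes refl | yes refl = ⊥-elim (y₁≢y₂ refl)
  ... | yes refl | no x≢y₂ with y₂ ∈? xs
  ...   | yes y₂∈ = ≤-trans (both (here refl) (there y₂∈)) (+-monoʳ-≤ (h x)
            (term≤sumℚ h xs y₂ u y₂∈ (λ z z∈ z≢y₂ → rest z (there z∈) (λ z≡x → All.lookup x∉xs z∈ (sym z≡x)) z≢y₂)))
  ...   | no y₂∉ = +-nonneg (only₁ (here refl) (∉-∷ (x≢y₂ ∘ sym) y₂∉))
            (sumℚ-nonneg h xs (λ z z∈ → rest z (there z∈) (λ z≡x → All.lookup x∉xs z∈ (sym z≡x))
               (λ z≡y₂ → y₂∉ (subst (_∈ xs) z≡y₂ z∈))))
  sumℚ-nonneg-pair h (x ∷ xs) y₁ y₂ (x∉xs ∷ u) y₁≢y₂ rest both only₁ only₂ | no x≢y₁ | yes refl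
    with y₁ ∈? xs
  ...   | yes y₁∈ = ≤-trans (subst (0ℚ ≤_) (+-comm (h y₁) (h x)) (both (there y₁∈) (here refl)))
            (+-monoʳ-≤ (h x) (term≤sumℚ h xs y₁ u y₁∈
              (λ z z∈ z≢y₁ → rest z (there z∈) z≢y₁ (λ z≡x → All.lookup x∉xs z∈ (sym z≡x)))))
  ...   | no y₁∉ = +-nonneg (only₂ (here refl) (∉-∷ (x≢y₁ ∘ sym) y₁∉))
            (sumℚ-nonneg h xs (λ z z∈ → rest z (there z∈) (λ z≡y₁ → y₁∉ (subst (_∈ xs) z≡y₁ z∈))
               (λ z≡x → All.lookup x∉xs z∈ (sym z≡x))))
  sumℚ-nonneg-pair h (x ∷ xs) y₁ y₂ (x∉xs ∷ u) y₁≢y₂ rest both only₁ only₂ | no x≢y₁ | no x≢y₂ =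
    +-nonneg (rest x (here refl) x≢y₁ x≢y₂)
      (sumℚ-nonneg-pair h xs y₁ y₂ u y₁≢y₂ (λ z z∈ → rest z (there z∈))
        (λ y₁∈ y₂∈ → both (there y₁∈) (there y₂∈))
        (λ y₁∈ y₂∉ → only₁ (there y₁∈) (∉-∷ (x≢y₂ ∘ sym) y₂∉))
        (λ y₂∈ y₁∉ → only₂ (there y₂∈) (∉-∷ (x≢y₁ ∘ sym) y₁∉)))

-- The numeric pair inequality
--
-- For a tuple write a = |R₁|, b = |R₂|, c = |R₁₂|.  Given the centre ℓ₁, the
-- node ℓ₂ is treated with probability min(c / b, 1), being appended iff
-- a ≤ c and made a singleton otherwise.

acceptProb : ℕ → ℕ → ℚ
acceptProb c zero    = 1ℚ
acceptProb c (suc k) = frac c (suc k) ⊓ 1ℚ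

acceptAction : ℕ → ℕ → Action
acceptAction a c = if a ≤ᵇ c then append else single

-- Number of pairs (ℓ₂ , r) that can be erroneous and coloured with the tuple
-- after decision d: appending errs on R₁ ∪ R₂, a singleton on R₁₂ ∪ R₂, and
-- doing nothing leaves only R₁₂ coloured.
errBound : ℕ → ℕ → ℕ → Action → ℕ
errBound a b c append  = a ℕ.+ b
errBound a b c single  = c ℕ.+ b
errBound a b c nothing = c

expectedErr : ℕ → ℕ → ℕ → ℚ
expectedErr a b c =
  𝔼 (bernoulli (acceptProb c b) (acceptAction a c) nothing) (fromℕ ∘ errBound a b c)

acceptProb-nonneg : ∀ c b → 0ℚ ≤ acceptProb c b
acceptProb-nonneg c zero    = 0≤1
acceptProb-nonneg c (suc k) = ⊓-glb (frac-nonneg c (suc k)) 0≤1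

acceptProb≤1 : ∀ c b → acceptProb c b ≤ 1ℚ
acceptProb≤1 c zero    = ≤-refl
acceptProb≤1 c (suc k) = p⊓q≤q (frac c (suc k)) 1ℚ

-- When b ≤ c the node is treated for sure.
expectedErr-certain : ∀ a b c → b ℕ.≤ c → expectedErr a b c ≡ fromℕ (errBound a b c (acceptAction a c))
expectedErr-certain a b c b≤c = begin
  expectedErr a b c                   ≡⟨ 𝔼-bernoulli p (acceptAction a c) nothing (fromℕ ∘ errBound a b c) ⟩
  p * X + (1ℚ - p) * fromℕ c          ≡⟨ cong (λ p → p * X + (1ℚ - p) * fromℕ c) (certain b b≤c) ⟩
  1ℚ * X + (1ℚ - 1ℚ) * fromℕ c        ≡⟨ solve 2 (λ X C → con 1ℚ :* X :+ (con 1ℚ :- con 1ℚ) :* C := X) refl X (fromℕ c) ⟩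
  X                                   ∎
  where
  open ≡-Reasoning
  p = acceptProb c b
  X = fromℕ (errBound a b c (acceptAction a c))
  certain : ∀ b → b ℕ.≤ c → acceptProb c b ≡ 1ℚ
  certain zero    _   = refl
  certain (suc k) b≤c = p≥q⇒p⊓q≡q (frac≥1 c k b≤c)

errBound-accept≤ : ∀ a b c → errBound a b c (acceptAction a c) ℕ.≤ c ℕ.+ b
errBound-accept≤ a b c with a ≤ᵇ c in a≤ᵇc
... | true  = ℕP.+-monoˡ-≤ b (ℕP.≤ᵇ⇒≤ a c (subst T (sym a≤ᵇc) tt))
... | false = ℕP.≤-refl

errBound-append : ∀ a b c → a ℕ.≤ c → errBound a b c (acceptAction a c) ≡ a ℕ.+ b
errBound-append a b c a≤c with a ≤ᵇ c in a≤ᵇc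
... | true  = refl
... | false = ⊥-elim (subst T a≤ᵇc (ℕP.≤⇒≤ᵇ a≤c))

-- The expected error count never exceeds 2c: the acceptance probability c / b
-- exactly pays the b extra pairs of an acceptance.
expectedErr≤2c : ∀ a b c → expectedErr a b c ≤ fromℕ c + fromℕ c
expectedErr≤2c a b c with b ℕ.≤? c
... | yes b≤c = begin
  expectedErr a b c                          ≡⟨ expectedErr-certain a b c b≤c ⟩
  fromℕ (errBound a b c (acceptAction a c))  ≤⟨ fromℕ-mono (ℕP.≤-trans (errBound-accept≤ a b c) (ℕP.+-monoʳ-≤ c b≤c)) ⟩
  fromℕ (c ℕ.+ c)                            ≡⟨ fromℕ-+ c c ⟩
  fromℕ c + fromℕ c                          ∎
  where open ≤-Reasoning
expectedErr≤2c a zero    c | no 0≰c = ⊥-elim (0≰c z≤n)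
expectedErr≤2c a (suc k) c | no b≰c = begin
  expectedErr a (suc k) c                    ≡⟨ 𝔼-bernoulli (acceptProb c (suc k)) (acceptAction a c) nothing (fromℕ ∘ errBound a (suc k) c) ⟩
  acceptProb c (suc k) * X + (1ℚ - acceptProb c (suc k)) * C
                                             ≡⟨ cong (λ p → p * X + (1ℚ - p) * C) (p≤q⇒p⊓q≡p (frac≤1 c k (ℕP.<⇒≤ (ℕP.≰⇒> b≰c)))) ⟩
  p * X + (1ℚ - p) * C                       ≤⟨ +-monoˡ-≤ ((1ℚ - p) * C) (*-monoˡ-≤-nonNeg p ⦃ nonNegative (frac-nonneg c (suc k)) ⦄ X≤C+B) ⟩
  p * (C + B) + (1ℚ - p) * C                 ≡⟨ solve 3 (λ p C B → p :* (C :+ B) :+ (con 1ℚ :- p) :* C := C :+ p :* B) refl p C B ⟩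
  C + p * B                                  ≡⟨ cong (λ z → C + z) (frac-cancel c k) ⟩
  C + C                                      ∎
  where
  open ≤-Reasoning
  p = frac c (suc k)
  X = fromℕ (errBound a (suc k) c (acceptAction a c))
  C = fromℕ c
  B = fromℕ (suc k)
  X≤C+B : X ≤ C + B
  X≤C+B = ≤-trans (fromℕ-mono (errBound-accept≤ a (suc k) c)) (≤-reflexive (fromℕ-+ c (suc k)))

-- α of a tuple, from c and s = min(c,a) + min(c,b), and the rate β / q = α · min(c,b)
-- (zero when c = 0).
αRatio : ℕ → ℕ → ℚ
αRatio c zero    = 1ℚ
αRatio c (suc d) = 1ℚ ⊓ frac c (suc d)

βRate : ℕ → ℕ → ℕ → ℚ
βRate zero    s k = 0ℚ
βRate (suc c) s k = αRatio (suc c) s * fromℕ k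

αRatio-nonneg : ∀ c s → 0ℚ ≤ αRatio c s
αRatio-nonneg c zero    = 0≤1
αRatio-nonneg c (suc d) = ⊓-glb 0≤1 (frac-nonneg c (suc d))

βRate-nonneg : ∀ c s k → 0ℚ ≤ βRate c s k
βRate-nonneg zero    s k = ≤-refl
βRate-nonneg (suc c) s k = *-nonneg (αRatio-nonneg (suc c) s) (fromℕ-nonneg k)

αRatio-one : ∀ c s → s ℕ.≤ c → αRatio c s ≡ 1ℚ
αRatio-one c zero    _   = refl
αRatio-one c (suc d) s≤c = p≤q⇒p⊓q≡p (frac≥1 c d s≤c)

αRatio-cancel : ∀ c s → c ℕ.≤ s → 0 ℕ.< c → αRatio c s * fromℕ s ≡ fromℕ c
αRatio-cancel (suc c) zero    () _
αRatio-cancel c       (suc d) c≤s _ =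
  trans (cong (_* fromℕ (suc d)) (p≥q⇒p⊓q≡q (frac≤1 c d c≤s))) (frac-cancel c d)

min-sum : ∀ c a b → c ℕ.≤ a ℕ.+ b → c ℕ.≤ c ℕ.⊓ a ℕ.+ c ℕ.⊓ b
min-sum c a b c≤a+b with ℕP.≤-total c a
... | inj₁ c≤a rewrite ℕP.m≤n⇒m⊓n≡m c≤a = ℕP.m≤m+n c _
... | inj₂ a≤c rewrite ℕP.m≥n⇒m⊓n≡n a≤c with ℕP.≤-total c b
...   | inj₁ c≤b rewrite ℕP.m≤n⇒m⊓n≡m c≤b = ℕP.m≤n+m c a
...   | inj₂ b≤c rewrite ℕP.m≥n⇒m⊓n≡n b≤c = c≤a+b

pairRate : ℕ → ℕ → ℕ → ℚ
pairRate a b c = βRate c (c ℕ.⊓ a ℕ.+ c ℕ.⊓ b) (c ℕ.⊓ b) + βRate c (c ℕ.⊓ b ℕ.+ c ℕ.⊓ a) (c ℕ.⊓ a)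

-- Small case a + b ≤ c: both nodes are appended for sure and α = 1.
pairBound-small : ∀ a b c → a ℕ.+ b ℕ.≤ suc c →
  expectedErr a b (suc c) + expectedErr b a (suc c) ≤ fromℕ 4 * pairRate a b (suc c)
pairBound-small a b c a+b≤c = begin
  expectedErr a b (suc c) + expectedErr b a (suc c)
    ≡⟨ cong₂ _+_ (appended a b a≤c b≤c) (appended b a b≤c a≤c) ⟩
  fromℕ (a ℕ.+ b) + fromℕ (b ℕ.+ a)
    ≡⟨ cong₂ _+_ (fromℕ-+ a b) (fromℕ-+ b a) ⟩
  (A + B) + (B + A)
    ≤⟨ ≤-+-nonneg ((A + B) + (B + A)) (+-nonneg (+-nonneg (+-nonneg 0≤A 0≤B) 0≤A) 0≤B) ⟩
  (A + B) + (B + A) + (A + B + A + B)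
    ≡⟨ solve 2 (λ A B → (A :+ B) :+ (B :+ A) :+ (A :+ B :+ A :+ B)
                       := (con 1ℚ :+ con 1ℚ :+ con 1ℚ :+ con 1ℚ) :* (con 1ℚ :* B :+ con 1ℚ :* A)) refl A B ⟩
  fromℕ 4 * (1ℚ * B + 1ℚ * A)
    ≡⟨ cong (fromℕ 4 *_) (sym (cong₂ _+_ (cong₂ _*_ (αRatio-one (suc c) _ s≤c) (cong fromℕ c⊓b≡b))
                                         (cong₂ _*_ (αRatio-one (suc c) _ s'≤c) (cong fromℕ c⊓a≡a)))) ⟩
  fromℕ 4 * pairRate a b (suc c)  ∎
  where
  open ≤-Reasoning
  A = fromℕ a
  B = fromℕ b
  0≤A = fromℕ-nonneg a
  0≤B = fromℕ-nonneg b
  a≤c = ℕP.≤-trans (ℕP.m≤m+n a b) a+b≤c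
  b≤c = ℕP.≤-trans (ℕP.m≤n+m b a) a+b≤c
  c⊓a≡a = ℕP.m≥n⇒m⊓n≡n a≤c
  c⊓b≡b = ℕP.m≥n⇒m⊓n≡n b≤c
  appended : ∀ x y → x ℕ.≤ suc c → y ℕ.≤ suc c → expectedErr x y (suc c) ≡ fromℕ (x ℕ.+ y)
  appended x y x≤c y≤c = trans (expectedErr-certain x y (suc c) y≤c) (cong fromℕ (errBound-append x y (suc c) x≤c))
  s≤c : suc c ℕ.⊓ a ℕ.+ suc c ℕ.⊓ b ℕ.≤ suc c
  s≤c rewrite c⊓a≡a | c⊓b≡b = a+b≤c
  s'≤c : suc c ℕ.⊓ b ℕ.+ suc c ℕ.⊓ a ℕ.≤ suc c
  s'≤c rewrite c⊓a≡a | c⊓b≡b = subst (ℕ._≤ suc c) (ℕP.+-comm a b) a+b≤c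

-- Large case c < a + b: each expectation is at most 2c, and
-- α · (min(c,a) + min(c,b)) = c.
pairBound-large : ∀ a b c → suc c ℕ.≤ a ℕ.+ b →
  expectedErr a b (suc c) + expectedErr b a (suc c) ≤ fromℕ 4 * pairRate a b (suc c)
pairBound-large a b c c<a+b = begin
  expectedErr a b (suc c) + expectedErr b a (suc c)
    ≤⟨ +-mono-≤ (expectedErr≤2c a b (suc c)) (expectedErr≤2c b a (suc c)) ⟩
  (C + C) + (C + C)
    ≡⟨ solve 1 (λ C → (C :+ C) :+ (C :+ C) := (con 1ℚ :+ con 1ℚ :+ con 1ℚ :+ con 1ℚ) :* C) refl C ⟩
  fromℕ 4 * C
    ≡⟨ cong (fromℕ 4 *_) (sym rates) ⟩
  fromℕ 4 * pairRate a b (suc c)  ∎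
  where
  open ≤-Reasoning
  C = fromℕ (suc c)
  Mb = suc c ℕ.⊓ b
  Ma = suc c ℕ.⊓ a
  α = αRatio (suc c) (Ma ℕ.+ Mb)
  rates : α * fromℕ Mb + αRatio (suc c) (Mb ℕ.+ Ma) * fromℕ Ma ≡ C
  rates = begin-equality
    α * fromℕ Mb + αRatio (suc c) (Mb ℕ.+ Ma) * fromℕ Ma
      ≡⟨ cong (λ s → α * fromℕ Mb + αRatio (suc c) s * fromℕ Ma) (ℕP.+-comm Mb Ma) ⟩
    α * fromℕ Mb + α * fromℕ Ma
      ≡⟨ solve 3 (λ α x y → α :* y :+ α :* x := α :* (x :+ y)) refl α (fromℕ Ma) (fromℕ Mb) ⟩
    α * (fromℕ Ma + fromℕ Mb)
      ≡⟨ cong (α *_) (sym (fromℕ-+ Ma Mb)) ⟩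
    α * fromℕ (Ma ℕ.+ Mb)
      ≡⟨ αRatio-cancel (suc c) (Ma ℕ.+ Mb) (min-sum (suc c) a b c<a+b) (s≤s z≤n) ⟩
    C ∎

-- The pair inequality: for counts (a, b, c) of T and (b, a, c) of T̄,
-- E[g_T] + E[g_T̄] ≤ 4 (β_T / q_T + β_T̄ / q_T̄).
pairBound : ∀ a b c → expectedErr a b c + expectedErr b a c ≤ fromℕ 4 * pairRate a b c
pairBound a b zero = +-mono-≤ (expectedErr≤2c a b 0) (expectedErr≤2c b a 0)
pairBound a b (suc c) with a ℕ.+ b ℕ.≤? suc c
... | yes a+b≤c = pairBound-small a b c a+b≤c
... | no  a+b≰c = pairBound-large a b c (ℕP.<⇒≤ (ℕP.≰⇒> a+b≰c))

count : {A : Set} → List A → (A → Bool) → ℕ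
count xs p = length (filterᵇ p xs)

count-∷ : {A : Set} (x : A) (xs : List A) (p : A → Bool) →
  count (x ∷ xs) p ≡ (if p x then suc (count xs p) else count xs p)
count-∷ x xs p with p x
... | true  = refl
... | false = refl

count-mono : {A : Set} (xs : List A) (p q : A → Bool) → (∀ x → p x ≡ true → q x ≡ true) →
  count xs p ℕ.≤ count xs q
count-mono []       p q p⇒q = z≤n
count-mono (x ∷ xs) p q p⇒q rewrite count-∷ x xs p | count-∷ x xs q with p x in px | q x in qx
... | true  | true  = s≤s (count-mono xs p q p⇒q)
... | true  | false with () ← trans (sym (p⇒q x px)) qx
... | false | true  = ℕP.m≤n⇒m≤1+n (count-mono xs p q p⇒q)
... | false | false = count-mono xs p q p⇒q

count-∨ : {A : Set} (xs : List A) (p q : A → Bool) →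
  count xs (λ x → p x ∨ q x) ℕ.≤ count xs p ℕ.+ count xs q
count-∨ []       p q = z≤n
count-∨ (x ∷ xs) p q rewrite count-∷ x xs (λ x → p x ∨ q x) | count-∷ x xs p | count-∷ x xs q
  with p x | q x
... | true  | true  = s≤s (ℕP.≤-trans (count-∨ xs p q) (ℕP.≤-trans (ℕP.m≤n+m _ 1) (ℕP.≤-reflexive (sym (ℕP.+-suc _ _)))))
... | true  | false = s≤s (count-∨ xs p q)
... | false | true  = ℕP.≤-trans (s≤s (count-∨ xs p q)) (ℕP.≤-reflexive (sym (ℕP.+-suc _ _)))
... | false | false = count-∨ xs p q

count-none : {A : Set} (xs : List A) (p : A → Bool) → (∀ x → p x ≡ false) → count xs p ≡ 0
count-none []       p p≡false = refl
count-none (x ∷ xs) p p≡false rewrite count-∷ x xs p | p≡false x = count-none xs p p≡false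

count-lookup : ∀ {k} (S : Subset k) → count (allFin k) (lookup S) ≡ ∣ S ∣
count-lookup {k} S = trans (count-tabulate id (lookup S)) (sym (∣∣-as-count S))
  where
  countFin : ∀ {j} → (Fin j → Bool) → ℕ
  countFin {zero}  h = 0
  countFin {suc j} h = if h Fin.zero then suc (countFin (h ∘ Fin.suc)) else countFin (h ∘ Fin.suc)
  count-tabulate : ∀ {j} {B : Set} (g : Fin j → B) (p : B → Bool) → count (tabulate g) p ≡ countFin (p ∘ g)
  count-tabulate {zero}  g p = refl
  count-tabulate {suc j} g p rewrite count-∷ (g Fin.zero) (tabulate (g ∘ Fin.suc)) p with p (g Fin.zero)
  ... | true  = cong suc (count-tabulate (g ∘ Fin.suc) p)
  ... | false = count-tabulate (g ∘ Fin.suc) p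
  ∣∣-as-count : ∀ {j} (S : Subset j) → ∣ S ∣ ≡ countFin (lookup S)
  ∣∣-as-count []ᵥ          = refl
  ∣∣-as-count (true  ∷ᵥ S) = cong suc (∣∣-as-count S)
  ∣∣-as-count (false ∷ᵥ S) = ∣∣-as-count S

sum-single : ∀ {k} (f : Fin k → ℕ) (y : Fin k) → (∀ x → ¬ x ≡ y → f x ≡ 0) →
  sum (map f (allFin k)) ≡ f y
sum-single {k} f y others≡0 = trans (cong sum (ListP.map-tabulate (λ x → x) f)) (sum-tabulate f y others≡0)
  where
  sum-zeros : ∀ j (h : Fin j → ℕ) → (∀ x → h x ≡ 0) → sum (tabulate h) ≡ 0
  sum-zeros zero    h h≡0 = refl
  sum-zeros (suc j) h h≡0 rewrite h≡0 Fin.zero = sum-zeros j (h ∘ Fin.suc) (h≡0 ∘ Fin.suc)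
  sum-tabulate : ∀ {j} (h : Fin j → ℕ) (y : Fin j) → (∀ x → ¬ x ≡ y → h x ≡ 0) → sum (tabulate h) ≡ h y
  sum-tabulate {suc j} h Fin.zero    h≡0 =
    trans (cong (h Fin.zero ℕ.+_) (sum-zeros j (h ∘ Fin.suc) (λ x → h≡0 (Fin.suc x) (λ ())))) (ℕP.+-identityʳ _)
  sum-tabulate {suc j} h (Fin.suc y) h≡0 rewrite h≡0 Fin.zero (λ ()) =
    sum-tabulate (h ∘ Fin.suc) y (λ x x≢y → h≡0 (Fin.suc x) (x≢y ∘ FinP.suc-injective))

T→≡ : ∀ {b} → T b → b ≡ true
T→≡ = Equivalence.to T-≡

≡→T : ∀ {b} → b ≡ true → T b
≡→T = Equivalence.from T-≡

∧-true : ∀ {x y} → x ∧ y ≡ true → x ≡ true × y ≡ true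
∧-true {true} {true} _ = refl , refl

∨-false : ∀ {x y} → x ∨ y ≡ false → x ≡ false × y ≡ false
∨-false {false} {false} _ = refl , refl

not-true : ∀ {b} → not b ≡ true → b ≡ false
not-true {false} _ = refl

∧-falseˡ : ∀ {x y} → x ≡ false → x ∧ y ≡ false
∧-falseˡ refl = refl

bool-cases : {P : Set} (b : Bool) → (b ≡ true → P) → (b ≡ false → P) → P
bool-cases true  t f = t refl
bool-cases false t f = f refl

does-true : ∀ {k} {x y : Fin k} → does (x ≟ y) ≡ true → x ≡ y
does-true {x = x} {y} _ with x ≟ y
... | yes x≡y = x≡y

does-false : ∀ {k} {x y : Fin k} → ¬ x ≡ y → does (x ≟ y) ≡ false
does-false {x = x} {y} x≢y with x ≟ y
... | yes x≡y = ⊥-elim (x≢y x≡y)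
... | no  _   = refl

does-refl : ∀ {k} (x : Fin k) → does (x ≟ x) ≡ true
does-refl x with x ≟ x
... | yes _   = refl
... | no x≢x  = ⊥-elim (x≢x refl)

lookup-∩ : ∀ {k} (p q : Subset k) x → lookup (p ∩ q) x ≡ lookup p x ∧ lookup q x
lookup-∩ p q x = VecP.lookup-zipWith _∧_ x p q

lookup-∪ : ∀ {k} (p q : Subset k) x → lookup (p ∪ q) x ≡ lookup p x ∨ lookup q x
lookup-∪ p q x = VecP.lookup-zipWith _∨_ x p q

lookup-─ : ∀ {k} (p q : Subset k) x → lookup (p ─ q) x ≡ lookup p x ∧ not (lookup q x)
lookup-─ (true  ∷ᵥ p) (true  ∷ᵥ q) Fin.zero    = refl
lookup-─ (true  ∷ᵥ p) (false ∷ᵥ q) Fin.zero    = refl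
lookup-─ (false ∷ᵥ p) (true  ∷ᵥ q) Fin.zero    = refl
lookup-─ (false ∷ᵥ p) (false ∷ᵥ q) Fin.zero    = refl
lookup-─ (_     ∷ᵥ p) (_     ∷ᵥ q) (Fin.suc x) = lookup-─ p q x

any-++ : {A : Set} (p : A → Bool) (xs ys : List A) → any p (xs ++ ys) ≡ any p xs ∨ any p ys
any-++ p []       ys = refl
any-++ p (x ∷ xs) ys rewrite any-++ p xs ys = sym (∨-assoc (p x) (any p xs) (any p ys))

any-none : {A : Set} (p : A → Bool) (xs : List A) → All (λ x → p x ≡ false) xs → any p xs ≡ false
any-none p []       []         = refl
any-none p (x ∷ xs) (px ∷ pxs) rewrite px = any-none p xs pxs

#R₁ #R₂ #R₁₂ : {m n : ℕ} → Tuple m n → ℕ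
#R₁  U = ∣ R₁ U ∣
#R₂  U = ∣ R₂ U ∣
#R₁₂ U = ∣ R₁₂ U ∣

errBoundOf : {m n : ℕ} → Tuple m n → Action → ℕ
errBoundOf U = errBound (#R₁ U) (#R₂ U) (#R₁₂ U)

βRateOf : {m n : ℕ} → Tuple m n → ℚ
βRateOf U = βRate (#R₁₂ U) (#R₁₂ U ℕ.⊓ #R₁ U ℕ.+ #R₁₂ U ℕ.⊓ #R₂ U) (#R₁₂ U ℕ.⊓ #R₂ U)

-- Runs of PivotBiCluster
module RunFacts {m n : ℕ} (G : Graph m n) where
  open Algorithm G

  decision-eq : (rR : Subset n) (ℓ₁ ℓ₂ : Fin m) → decision rR ℓ₁ ℓ₂ ≡
    bernoulli (acceptProb ∣ Nb rR ℓ₁ ∩ Nb rR ℓ₂ ∣ ∣ Nb rR ℓ₂ ─ Nb rR ℓ₁ ∣)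
              (acceptAction ∣ Nb rR ℓ₁ ─ Nb rR ℓ₂ ∣ ∣ Nb rR ℓ₁ ∩ Nb rR ℓ₂ ∣) nothing
  decision-eq rR ℓ₁ ℓ₂ with ∣ Nb rR ℓ₂ ─ Nb rR ℓ₁ ∣
  ... | zero  = refl
  ... | suc k = refl

  Supported-decision : (rR : Subset n) (ℓ₁ ℓ₂ : Fin m) → Supported (λ _ → Unit) (decision rR ℓ₁ ℓ₂)
  Supported-decision rR ℓ₁ ℓ₂ = subst (Supported (λ _ → Unit)) (sym (decision-eq rR ℓ₁ ℓ₂))
    (Supported-bernoulli (acceptAction ∣ N₁ ─ N₂ ∣ ∣ N₁ ∩ N₂ ∣) nothing
      (acceptProb-nonneg ∣ N₁ ∩ N₂ ∣ ∣ N₂ ─ N₁ ∣) (acceptProb≤1 ∣ N₁ ∩ N₂ ∣ ∣ N₂ ─ N₁ ∣))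
    where
    N₁ = Nb rR ℓ₁
    N₂ = Nb rR ℓ₂

  Mass1-decision : (rR : Subset n) (ℓ₁ ℓ₂ : Fin m) → Mass1 (decision rR ℓ₁ ℓ₂)
  Mass1-decision rR ℓ₁ ℓ₂ = subst Mass1 (sym (decision-eq rR ℓ₁ ℓ₂))
    (Mass1-bernoulli (acceptProb ∣ N₁ ∩ N₂ ∣ ∣ N₂ ─ N₁ ∣) (acceptAction ∣ N₁ ─ N₂ ∣ ∣ N₁ ∩ N₂ ∣) nothing)
    where
    N₁ = Nb rR ℓ₁
    N₂ = Nb rR ℓ₂

  Supported-decisions : (rR : Subset n) (ℓ₁ : Fin m) (ls : List (Fin m)) →
    Supported (λ _ → Unit) (decisions rR ℓ₁ ls)
  Supported-decisions rR ℓ₁ []       = Supported-return _ tt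
  Supported-decisions rR ℓ₁ (x ∷ ls) =
    Supported-bind (decisions rR ℓ₁ ls) (λ f → decision rR ℓ₁ x >>= λ a → return (update f x a))
      (Supported-decisions rR ℓ₁ ls) λ f _ →
    Supported-bind (decision rR ℓ₁ x) (λ a → return (update f x a)) (Supported-decision rR ℓ₁ x) λ a _ →
    Supported-return _ tt

  Mass1-decisions : (rR : Subset n) (ℓ₁ : Fin m) (ls : List (Fin m)) → Mass1 (decisions rR ℓ₁ ls)
  Mass1-decisions rR ℓ₁ []       = refl
  Mass1-decisions rR ℓ₁ (x ∷ ls) =
    Mass1-bind (decisions rR ℓ₁ ls) (λ f → decision rR ℓ₁ x >>= λ a → return (update f x a))
      (Mass1-decisions rR ℓ₁ ls) λ f →
    Mass1-bind (decision rR ℓ₁ x) (λ a → return (update f x a)) (Mass1-decision rR ℓ₁ x) λ a → refl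

  𝔼-decisions-at : (rR : Subset n) (ℓ₁ : Fin m) (ls : List (Fin m)) (x : Fin m) (u : Action → ℚ) →
    x ∈ ls → 𝔼 (decisions rR ℓ₁ ls) (λ f → u (f x)) ≡ 𝔼 (decision rR ℓ₁ x) u
  𝔼-decisions-at rR ℓ₁ (y ∷ ls) x u x∈ = trans unfold (last-or-earlier x∈)
    where
    unfold : 𝔼 (decisions rR ℓ₁ (y ∷ ls)) (λ f → u (f x))
           ≡ 𝔼 (decisions rR ℓ₁ ls) (λ f → 𝔼 (decision rR ℓ₁ y) (λ a → u (update f y a x)))
    unfold = trans (𝔼-bind (decisions rR ℓ₁ ls) (λ f → decision rR ℓ₁ y >>= λ a → return (update f y a)) (λ g → u (g x)))
      (𝔼-cong (decisions rR ℓ₁ ls) λ f →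
        trans (𝔼-bind (decision rR ℓ₁ y) (λ a → return (update f y a)) (λ g → u (g x)))
          (𝔼-cong (decision rR ℓ₁ y) λ a → 𝔼-return (update f y a) (λ g → u (g x))))
    last-or-earlier : x ∈ (y ∷ ls) →
      𝔼 (decisions rR ℓ₁ ls) (λ f → 𝔼 (decision rR ℓ₁ y) (λ a → u (update f y a x))) ≡ 𝔼 (decision rR ℓ₁ x) u
    last-or-earlier x∈ with x ≟ y
    ... | yes refl = 𝔼-const (decisions rR ℓ₁ ls) _ (Mass1-decisions rR ℓ₁ ls)
    ... | no x≢y with x∈
    ...   | here x≡y   = ⊥-elim (x≢y x≡y)
    ...   | there x∈ls = trans
            (𝔼-cong (decisions rR ℓ₁ ls) (λ f → 𝔼-const (decision rR ℓ₁ y) (u (f x)) (Mass1-decision rR ℓ₁ y)))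
            (𝔼-decisions-at rR ℓ₁ ls x u x∈ls)

  -- Valid rL rR tr: tr can be produced by `run` from the state (rL , rR).
  Valid : Subset m → Subset n → Trace m n → Set
  Valid rL rR []        = Unit
  Valid rL rR (ph ∷ tr) = remL ph ≡ rL × remR ph ≡ rR × T (lookup rL (center ph))
    × Valid (rL ─ removedL (decide ph) rL (center ph)) (rR ─ Nb rR (center ph)) tr

  others : List (Fin m) → Fin m → List (Fin m)
  others ls ℓ₁ = filterᵇ (λ x → not (does (x ≟ ℓ₁))) ls

  members-present : (rL : Subset m) → All (λ ℓ → T (lookup rL ℓ)) (members rL)
  members-present rL = AllP.all-filter (T? ∘ lookup rL) (allFin m)

  afterDecisions : ℕ → Subset m → Subset n → Fin m → (Fin m → Action) → Dist (Trace m n)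
  afterDecisions k rL rR ℓ f =
    run k (rL ─ removedL f rL ℓ) (rR ─ Nb rR ℓ) >>= λ tr → return (phase rL rR ℓ f ∷ tr)

  phaseWithCentre : ℕ → Subset m → Subset n → List (Fin m) → Fin m → Dist (Trace m n)
  phaseWithCentre k rL rR ls ℓ = decisions rR ℓ (others ls ℓ) >>= afterDecisions k rL rR ℓ

  Supported-run : (k : ℕ) (rL : Subset m) (rR : Subset n) → Supported (Valid rL rR) (run k rL rR)
  Supported-run zero    rL rR = Supported-return _ tt
  Supported-run (suc k) rL rR with members rL in eq
  ... | []     = Supported-return _ tt
  ... | x ∷ xs =
    Supported-bind (uniform (x ∷ xs)) (phaseWithCentre k rL rR (x ∷ xs))
      (Supported-uniform x xs (subst (All (λ ℓ → T (lookup rL ℓ))) eq (members-present rL))) λ ℓ present →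
    Supported-bind (decisions rR ℓ (others (x ∷ xs) ℓ)) (afterDecisions k rL rR ℓ)
      (Supported-decisions rR ℓ (others (x ∷ xs) ℓ)) λ f _ →
    Supported-bind (run k (rL ─ removedL f rL ℓ) (rR ─ Nb rR ℓ)) (λ tr → return (phase rL rR ℓ f ∷ tr))
      (Supported-run k _ _) λ tr valid →
    Supported-return _ (refl , refl , present , valid)

  Mass1-afterDecisions : ∀ k rL rR ℓ f → Mass1 (afterDecisions k rL rR ℓ f)

  Mass1-run : (k : ℕ) (rL : Subset m) (rR : Subset n) → Mass1 (run k rL rR)
  Mass1-run zero    rL rR = refl
  Mass1-run (suc k) rL rR with members rL
  ... | []     = refl
  ... | x ∷ xs =
    Mass1-bind (uniform (x ∷ xs)) (phaseWithCentre k rL rR (x ∷ xs)) (Mass1-uniform x xs) λ ℓ →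
    Mass1-bind (decisions rR ℓ (others (x ∷ xs) ℓ)) (afterDecisions k rL rR ℓ) (Mass1-decisions rR ℓ (others (x ∷ xs) ℓ))
      (Mass1-afterDecisions k rL rR ℓ)

  Mass1-afterDecisions k rL rR ℓ f =
    Mass1-bind (run k (rL ─ removedL f rL ℓ) (rR ─ Nb rR ℓ)) (λ tr → return (phase rL rR ℓ f ∷ tr))
      (Mass1-run k _ _) λ tr → refl

  lookup-Nb : ∀ rR ℓ r → lookup (Nb rR ℓ) r ≡ lookup (G ℓ) r ∧ lookup rR r
  lookup-Nb rR ℓ r = lookup-∩ (G ℓ) rR r

  lookup-removedL : ∀ f rL c x →
    lookup (removedL f rL c) x ≡ (does (x ≟ c) ∨ (lookup rL x ∧ not (isNothing (f x))))
  lookup-removedL f rL c x = VecP.lookup∘tabulate _ x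

  centre-removed : ∀ f rL c → lookup (rL ─ removedL f rL c) c ≡ false
  centre-removed f rL c rewrite lookup-─ rL (removedL f rL c) c | lookup-removedL f rL c c | does-refl c =
    ∧-zeroʳ (lookup rL c)

  neighbour-removed : ∀ rR ℓ r → lookup (Nb rR ℓ) r ≡ true → lookup (rR ─ Nb rR ℓ) r ≡ false
  neighbour-removed rR ℓ r r∈N rewrite lookup-─ rR (Nb rR ℓ) r | r∈N = ∧-zeroʳ (lookup rR r)

  absentˡ : ∀ rL rR tr ℓ → Valid rL rR tr → lookup rL ℓ ≡ false →
    All (λ ph → lookup (remL ph) ℓ ≡ false × ¬ center ph ≡ ℓ) tr
  absentˡ rL rR []                        ℓ valid             ℓ∉ = []
  absentˡ rL rR (phase _ _ c f ∷ tr) ℓ (refl , refl , c∈ , valid) ℓ∉ =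
    (ℓ∉ , λ { refl → subst T ℓ∉ c∈ }) ∷
    absentˡ _ _ tr ℓ valid (trans (lookup-─ rL (removedL f rL c) ℓ) (∧-falseˡ ℓ∉))

  absentʳ : ∀ rL rR tr r → Valid rL rR tr → lookup rR r ≡ false →
    All (λ ph → lookup (remR ph) r ≡ false) tr
  absentʳ rL rR []                   r valid              r∉ = []
  absentʳ rL rR (phase _ _ c f ∷ tr) r (refl , refl , _ , valid) r∉ =
    r∉ ∷ absentʳ _ _ tr r valid (trans (lookup-─ rR (Nb rR c) r) (∧-falseˡ r∉))

  sameCluster-absent : ∀ tr ℓ r → All (λ ph → lookup (remR ph) r ≡ false) tr → sameCluster tr ℓ r ≡ false
  sameCluster-absent []        ℓ r []        = refl
  sameCluster-absent (ph ∷ tr) ℓ r (r∉ ∷ rs) rewrite lookup-Nb (remR ph) (center ph) r | r∉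
    | ∧-zeroʳ (lookup (G (center ph)) r) | ∧-zeroʳ (does (ℓ ≟ center ph) ∨ isAppend (decide ph ℓ)) =
    sameCluster-absent tr ℓ r rs

  Unclustered : Trace m n → Subset m → Set
  Unclustered pre rL = ∀ ℓ → lookup rL ℓ ≡ true → ∀ r → sameCluster pre ℓ r ≡ false

  Unclustered-step : (pre : Trace m n) (rL : Subset m) (rR : Subset n) (c : Fin m) (f : Fin m → Action) →
    Unclustered pre rL → Unclustered (pre ++ phase rL rR c f ∷ []) (rL ─ removedL f rL c)
  Unclustered-step pre rL rR c f unclustered ℓ survives r =
    trans (any-++ _ pre (phase rL rR c f ∷ []))
      (cong₂ _∨_ (unclustered ℓ present r)
        (cong (_∨ false) (cong₂ (λ a b → (a ∨ b) ∧ (r ∈ᵇ Nb rR c)) not-centre not-appended)))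
    where
    survives′ : lookup rL ℓ ∧ not (lookup (removedL f rL c) ℓ) ≡ true
    survives′ = trans (sym (lookup-─ rL (removedL f rL c) ℓ)) survives
    present = proj₁ (∧-true survives′)
    not-removed : does (ℓ ≟ c) ∨ (lookup rL ℓ ∧ not (isNothing (f ℓ))) ≡ false
    not-removed = trans (sym (lookup-removedL f rL c ℓ)) (not-true (proj₂ (∧-true survives′)))
    not-centre = proj₁ (∨-false not-removed)
    not-appended : isAppend (f ℓ) ≡ false
    not-appended with f ℓ | proj₂ (∨-false {does (ℓ ≟ c)} not-removed)
    ... | append  | e = trans (cong (_∧ true) (sym present)) e
    ... | single  | _ = refl
    ... | nothing | _ = refl

errTarget : Action → Bool → Bool → Bool → Bool
errTarget append  x₁ x₁₂ x₂ = x₁ ∨ x₂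
errTarget single  x₁ x₁₂ x₂ = x₁₂ ∨ x₂
errTarget nothing x₁ x₁₂ x₂ = x₁₂

-- On R₁ the pair is a non-edge, on R₁₂ an edge, and on both it lies in one
-- cluster iff d = append; so an erroneous coloured pair lies in errTarget d.
errTarget-complete : ∀ d x₁ x₁₂ x₂ edge same →
  (x₁  ≡ true → edge ≡ false × same ≡ isAppend d) →
  (x₁₂ ≡ true → edge ≡ true  × same ≡ isAppend d) →
  (edge xor same) ∧ ((x₁ ∨ x₁₂) ∨ (x₂ ∧ not (isNothing d))) ≡ true → errTarget d x₁ x₁₂ x₂ ≡ true
errTarget-complete append  true  _     _     _ _ on-R₁ on-R₁₂ _ = refl
errTarget-complete single  true  _     _     _ _ on-R₁ on-R₁₂ e with on-R₁ refl | e
... | refl , refl | ()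
errTarget-complete nothing true  _     _     _ _ on-R₁ on-R₁₂ e with on-R₁ refl | e
... | refl , refl | ()
errTarget-complete append  false true  _     _ _ on-R₁ on-R₁₂ e with on-R₁₂ refl | e
... | refl , refl | ()
errTarget-complete single  false true  _     _ _ on-R₁ on-R₁₂ _ = refl
errTarget-complete nothing false true  _     _ _ on-R₁ on-R₁₂ _ = refl
errTarget-complete append  false false true  _ _ on-R₁ on-R₁₂ _ = refl
errTarget-complete single  false false true  _ _ on-R₁ on-R₁₂ _ = refl
errTarget-complete nothing false false true  edge same on-R₁ on-R₁₂ e = trans (sym (∧-zeroʳ (edge xor same))) e
errTarget-complete append  false false false edge same on-R₁ on-R₁₂ e = trans (sym (∧-zeroʳ (edge xor same))) e
errTarget-complete single  false false false edge same on-R₁ on-R₁₂ e = trans (sym (∧-zeroʳ (edge xor same))) e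
errTarget-complete nothing false false false edge same on-R₁ on-R₁₂ e = trans (sym (∧-zeroʳ (edge xor same))) e

errTarget-count : {m n : ℕ} (U : Tuple m n) (d : Action) →
  count (allFin n) (λ r → errTarget d (lookup (R₁ U) r) (lookup (R₁₂ U) r) (lookup (R₂ U) r)) ℕ.≤ errBoundOf U d
errTarget-count {n = n} U append = ℕP.≤-trans (count-∨ (allFin n) (lookup (R₁ U)) (lookup (R₂ U)))
  (ℕP.≤-reflexive (cong₂ ℕ._+_ (count-lookup (R₁ U)) (count-lookup (R₂ U))))
errTarget-count {n = n} U single = ℕP.≤-trans (count-∨ (allFin n) (lookup (R₁₂ U)) (lookup (R₂ U)))
  (ℕP.≤-reflexive (cong₂ ℕ._+_ (count-lookup (R₁₂ U)) (count-lookup (R₂ U))))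
errTarget-count {n = n} U nothing = ℕP.≤-reflexive (count-lookup (R₁₂ U))

-- The event X_T
module EventFacts {m n : ℕ} (G : Graph m n) where
  open Algorithm G
  open Analysis G hiding (count)
  open RunFacts G

  subsetEq-sound : (a b : Subset n) → subsetEqᵇ a b ≡ true → a ≡ b
  subsetEq-sound a b _ with VecP.≡-dec Bool._≟_ a b
  ... | yes a≡b = a≡b

  subsetEq-complete : (a b : Subset n) → a ≡ b → subsetEqᵇ a b ≡ true
  subsetEq-complete a b a≡b with VecP.≡-dec Bool._≟_ a b
  ... | yes _   = refl
  ... | no  a≢b = ⊥-elim (a≢b a≡b)

  record XHolds (U : Tuple m n) (ph : Phase m n) : Set where
    field
      centre  : center ph ≡ ℓ₁ U
      present : lookup (remL ph) (ℓ₂ U) ≡ true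
      R₁-eq   : R₁ U ≡ Nb (remR ph) (ℓ₁ U) ─ Nb (remR ph) (ℓ₂ U)
      R₁₂-eq  : R₁₂ U ≡ Nb (remR ph) (ℓ₁ U) ∩ Nb (remR ph) (ℓ₂ U)
      R₂-eq   : R₂ U ≡ Nb (remR ph) (ℓ₂ U) ─ Nb (remR ph) (ℓ₁ U)

  X-sound : (U : Tuple m n) (ph : Phase m n) → XᵀAt U ph ≡ true → XHolds U ph
  X-sound U ph hit =
    let (is-centre , rest₁) = ∧-true {does (center ph ≟ ℓ₁ U)} hit
        (present , rest₂)   = ∧-true {lookup (remL ph) (ℓ₂ U)} rest₁
        (eq₁ , rest₃)       = ∧-true {subsetEqᵇ (R₁ U) _} rest₂
        (eq₁₂ , eq₂)        = ∧-true {subsetEqᵇ (R₁₂ U) _} rest₃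
    in record { centre = does-true is-centre ; present = present ; R₁-eq = subsetEq-sound _ _ eq₁
              ; R₁₂-eq = subsetEq-sound _ _ eq₁₂ ; R₂-eq = subsetEq-sound _ _ eq₂ }

  X-complete : (U : Tuple m n) (ph : Phase m n) → XHolds U ph → XᵀAt U ph ≡ true
  X-complete U ph holds rewrite XHolds.centre holds | does-refl (ℓ₁ U) | XHolds.present holds
    | subsetEq-complete _ _ (XHolds.R₁-eq holds) | subsetEq-complete _ _ (XHolds.R₁₂-eq holds)
    | subsetEq-complete _ _ (XHolds.R₂-eq holds) = refl

  X-off-centre : (U : Tuple m n) (ph : Phase m n) → ¬ center ph ≡ ℓ₁ U → XᵀAt U ph ≡ false
  X-off-centre U ph c≢ℓ₁ rewrite does-false c≢ℓ₁ = refl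

  X-absent : (U : Tuple m n) (ph : Phase m n) → lookup (remL ph) (ℓ₂ U) ≡ false → XᵀAt U ph ≡ false
  X-absent U ph ℓ₂∉ rewrite ℓ₂∉ = ∧-zeroʳ (does (center ph ≟ ℓ₁ U))

  X-conj : (U : Tuple m n) (rL : Subset m) (rR : Subset n) (f f′ : Fin m → Action) →
    XᵀAt U (phase rL rR (ℓ₁ U) f) ≡ true → lookup rL (ℓ₁ U) ≡ true →
    XᵀAt (conj U) (phase rL rR (ℓ₂ U) f′) ≡ true
  X-conj U rL rR f f′ hit ℓ₁∈ = X-complete (conj U) (phase rL rR (ℓ₂ U) f′) (record
    { centre = refl ; present = ℓ₁∈ ; R₁-eq = XHolds.R₂-eq holds
    ; R₁₂-eq = trans (XHolds.R₁₂-eq holds) (∩-comm (Nb rR (ℓ₁ U)) (Nb rR (ℓ₂ U)))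
    ; R₂-eq = XHolds.R₁-eq holds })
    where holds = X-sound U (phase rL rR (ℓ₁ U) f) hit

  decision-at-X : (U : Tuple m n) (ph : Phase m n) → XᵀAt U ph ≡ true →
    decision (remR ph) (ℓ₁ U) (ℓ₂ U) ≡ bernoulli (acceptProb (#R₁₂ U) (#R₂ U)) (acceptAction (#R₁ U) (#R₁₂ U)) nothing
  decision-at-X U ph hit rewrite decision-eq (remR ph) (ℓ₁ U) (ℓ₂ U)
    | sym (XHolds.R₁-eq (X-sound U ph hit)) | sym (XHolds.R₁₂-eq (X-sound U ph hit))
    | sym (XHolds.R₂-eq (X-sound U ph hit)) = refl

  R₁-member : (U : Tuple m n) (ph : Phase m n) (r : Fin n) → XHolds U ph → lookup (R₁ U) r ≡ true →
    lookup (Nb (remR ph) (ℓ₁ U)) r ≡ true × lookup (G (ℓ₂ U)) r ≡ false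
  R₁-member U ph r holds r∈ = r∈N₁ , edge-absent
    where
    N₁ = Nb (remR ph) (ℓ₁ U)
    N₂ = Nb (remR ph) (ℓ₂ U)
    r∈N₁─N₂ : lookup N₁ r ∧ not (lookup N₂ r) ≡ true
    r∈N₁─N₂ = trans (sym (trans (cong (λ S → lookup S r) (XHolds.R₁-eq holds)) (lookup-─ N₁ N₂ r))) r∈
    r∈N₁ = proj₁ (∧-true r∈N₁─N₂)
    r-present : lookup (remR ph) r ≡ true
    r-present = proj₂ (∧-true {lookup (G (ℓ₁ U)) r} (trans (sym (lookup-Nb (remR ph) (ℓ₁ U) r)) r∈N₁))
    edge-absent : lookup (G (ℓ₂ U)) r ≡ false
    edge-absent = trans (sym (∧-identityʳ _)) (trans (cong (lookup (G (ℓ₂ U)) r ∧_) (sym r-present))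
      (trans (sym (lookup-Nb (remR ph) (ℓ₂ U) r)) (not-true (proj₂ (∧-true {lookup N₁ r} r∈N₁─N₂)))))

  R₁₂-member : (U : Tuple m n) (ph : Phase m n) (r : Fin n) → XHolds U ph → lookup (R₁₂ U) r ≡ true →
    lookup (Nb (remR ph) (ℓ₁ U)) r ≡ true × lookup (G (ℓ₂ U)) r ≡ true
  R₁₂-member U ph r holds r∈ = proj₁ r∈N₁∩N₂ , edge-present
    where
    N₁ = Nb (remR ph) (ℓ₁ U)
    N₂ = Nb (remR ph) (ℓ₂ U)
    r∈N₁∩N₂ = ∧-true {lookup N₁ r}
      (trans (sym (trans (cong (λ S → lookup S r) (XHolds.R₁₂-eq holds)) (lookup-∩ N₁ N₂ r))) r∈)
    edge-present : lookup (G (ℓ₂ U)) r ≡ true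
    edge-present = proj₁ (∧-true {lookup (G (ℓ₂ U)) r}
      (trans (sym (lookup-Nb (remR ph) (ℓ₂ U) r)) (proj₂ r∈N₁∩N₂)))

  -- Colour U is only given to pairs at ℓ₂ U, so cost(U) counts right nodes only.
  cost-at-ℓ₂ : (U : Tuple m n) (tr : Trace m n) →
    cost U tr ≡ count (allFin n) (λ r → erroneous tr (ℓ₂ U) r ∧ colored U tr (ℓ₂ U) r)
  cost-at-ℓ₂ U tr = sum-single (λ ℓ → count (allFin n) (λ r → erroneous tr ℓ r ∧ colored U tr ℓ r)) (ℓ₂ U)
    λ ℓ ℓ≢ℓ₂ → count-none (allFin n) _ λ r →
      trans (cong (erroneous tr ℓ r ∧_) (uncoloured ℓ ℓ≢ℓ₂ r)) (∧-zeroʳ _)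
    where
    uncoloured : ∀ ℓ → ¬ ℓ ≡ ℓ₂ U → ∀ r → colored U tr ℓ r ≡ false
    uncoloured ℓ ℓ≢ℓ₂ r = any-none _ tr (All.universal (λ p →
      trans (cong (XᵀAt U p ∧_) (∧-falseˡ (does-false ℓ≢ℓ₂))) (∧-zeroʳ (XᵀAt U p))) tr)

  colored-at-hit : (U : Tuple m n) (pre : Trace m n) (ph : Phase m n) (tr′ : Trace m n) (r : Fin n) →
    XᵀAt U ph ≡ true → All (λ p → XᵀAt U p ≡ false) pre → All (λ p → XᵀAt U p ≡ false) tr′ →
    colored U (pre ++ ph ∷ tr′) (ℓ₂ U) r
      ≡ (lookup (R₁ U) r ∨ lookup (R₁₂ U) r) ∨ (lookup (R₂ U) r ∧ not (isNothing (decide ph (ℓ₂ U))))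
  colored-at-hit U pre ph tr′ r hit noHitBefore noHitAfter = begin
    any (colourAt r) (pre ++ ph ∷ tr′)
      ≡⟨ any-++ (colourAt r) pre (ph ∷ tr′) ⟩
    any (colourAt r) pre ∨ (colourAt r ph ∨ any (colourAt r) tr′)
      ≡⟨ cong₂ (λ a b → a ∨ (colourAt r ph ∨ b)) (any-none _ pre (All.map (cong (_∧ _)) noHitBefore))
                                                 (any-none _ tr′ (All.map (cong (_∧ _)) noHitAfter)) ⟩
    colourAt r ph ∨ false
      ≡⟨ ∨-identityʳ (colourAt r ph) ⟩
    colourAt r ph
      ≡⟨ cong₂ (λ a b → a ∧ b ∧ ((r ∈ᵇ (R₁ U ∪ R₁₂ U)) ∨ ((r ∈ᵇ R₂ U) ∧ not (isNothing d)))) hit (does-refl (ℓ₂ U)) ⟩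
    (r ∈ᵇ (R₁ U ∪ R₁₂ U)) ∨ ((r ∈ᵇ R₂ U) ∧ not (isNothing d))
      ≡⟨ cong (_∨ ((r ∈ᵇ R₂ U) ∧ not (isNothing d))) (lookup-∪ (R₁ U) (R₁₂ U) r) ⟩
    (lookup (R₁ U) r ∨ lookup (R₁₂ U) r) ∨ (lookup (R₂ U) r ∧ not (isNothing d)) ∎
    where
    open ≡-Reasoning
    d = decide ph (ℓ₂ U)
    colourAt : Fin n → Phase m n → Bool
    colourAt r p = XᵀAt U p ∧ does (ℓ₂ U ≟ ℓ₂ U)
      ∧ ((r ∈ᵇ (R₁ U ∪ R₁₂ U)) ∨ ((r ∈ᵇ R₂ U) ∧ not (isNothing (decide p (ℓ₂ U)))))

  -- If ℓ₂ U is unclustered before the hit phase and r is a current neighbour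
  -- of the centre (hence removed afterwards), then ℓ₂ U and r share a cluster
  -- iff ℓ₂ U was appended.
  sameCluster-at-hit : (U : Tuple m n) → ¬ ℓ₁ U ≡ ℓ₂ U → (pre : Trace m n) (ph : Phase m n) (tr′ : Trace m n)
    (r : Fin n) → XHolds U ph → sameCluster pre (ℓ₂ U) r ≡ false →
    All (λ p → lookup (remR p) r ≡ false) tr′ → lookup (Nb (remR ph) (ℓ₁ U)) r ≡ true →
    sameCluster (pre ++ ph ∷ tr′) (ℓ₂ U) r ≡ isAppend (decide ph (ℓ₂ U))
  sameCluster-at-hit U ℓ₁≢ℓ₂ pre ph tr′ r holds unclustered gone r∈N₁ = begin
    any joins (pre ++ ph ∷ tr′)                   ≡⟨ any-++ joins pre (ph ∷ tr′) ⟩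
    any joins pre ∨ (joins ph ∨ any joins tr′)    ≡⟨ cong₂ (λ a b → a ∨ (joins ph ∨ b)) unclustered
                                                              (sameCluster-absent tr′ (ℓ₂ U) r gone) ⟩
    joins ph ∨ false                              ≡⟨ ∨-identityʳ (joins ph) ⟩
    joins ph                                      ≡⟨ cong (λ c → (does (ℓ₂ U ≟ c) ∨ isAppend d) ∧ (r ∈ᵇ Nb (remR ph) c))
                                                          (XHolds.centre holds) ⟩
    (does (ℓ₂ U ≟ ℓ₁ U) ∨ isAppend d) ∧ lookup (Nb (remR ph) (ℓ₁ U)) r
                                                  ≡⟨ cong₂ (λ a b → (a ∨ isAppend d) ∧ b) (does-false (ℓ₁≢ℓ₂ ∘ sym)) r∈N₁ ⟩
    isAppend d ∧ true                             ≡⟨ ∧-identityʳ (isAppend d) ⟩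
    isAppend d                                    ∎
    where
    open ≡-Reasoning
    d = decide ph (ℓ₂ U)
    joins : Phase m n → Bool
    joins p = (does (ℓ₂ U ≟ center p) ∨ isAppend (decide p (ℓ₂ U))) ∧ (r ∈ᵇ Nb (remR p) (center p))

  cost-at-hit : (U : Tuple m n) → ¬ ℓ₁ U ≡ ℓ₂ U → (pre : Trace m n) (ph : Phase m n) (tr′ : Trace m n) →
    XᵀAt U ph ≡ true → All (λ p → XᵀAt U p ≡ false) pre → (∀ r → sameCluster pre (ℓ₂ U) r ≡ false) →
    All (λ p → XᵀAt U p ≡ false) tr′ →
    (∀ r → lookup (Nb (remR ph) (ℓ₁ U)) r ≡ true → All (λ p → lookup (remR p) r ≡ false) tr′) →
    cost U (pre ++ ph ∷ tr′) ℕ.≤ errBoundOf U (decide ph (ℓ₂ U))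
  cost-at-hit U ℓ₁≢ℓ₂ pre ph tr′ hit noHitBefore unclustered noHitAfter neighboursGone = begin
    cost U tr                                                      ≡⟨ cost-at-ℓ₂ U tr ⟩
    count (allFin n) (λ r → erroneous tr (ℓ₂ U) r ∧ colored U tr (ℓ₂ U) r)
                                                                   ≤⟨ count-mono (allFin n) _ _ in-target ⟩
    count (allFin n) (λ r → errTarget d (lookup (R₁ U) r) (lookup (R₁₂ U) r) (lookup (R₂ U) r))
                                                                   ≤⟨ errTarget-count U d ⟩
    errBoundOf U d                                                 ∎
    where
    open ℕP.≤-Reasoning
    tr = pre ++ ph ∷ tr′
    d = decide ph (ℓ₂ U)
    holds = X-sound U ph hit
    joins-iff-append : ∀ r → lookup (Nb (remR ph) (ℓ₁ U)) r ≡ true → sameCluster tr (ℓ₂ U) r ≡ isAppend d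
    joins-iff-append r r∈N₁ =
      sameCluster-at-hit U ℓ₁≢ℓ₂ pre ph tr′ r holds (unclustered r) (neighboursGone r r∈N₁) r∈N₁
    in-target : ∀ r → (erroneous tr (ℓ₂ U) r ∧ colored U tr (ℓ₂ U) r) ≡ true →
      errTarget d (lookup (R₁ U) r) (lookup (R₁₂ U) r) (lookup (R₂ U) r) ≡ true
    in-target r e = errTarget-complete d _ _ _ (lookup (G (ℓ₂ U)) r) (sameCluster tr (ℓ₂ U) r)
      (λ r∈R₁ → let (r∈N₁ , non-edge) = R₁-member U ph r holds r∈R₁ in non-edge , joins-iff-append r r∈N₁)
      (λ r∈R₁₂ → let (r∈N₁ , edge) = R₁₂-member U ph r holds r∈R₁₂ in edge , joins-iff-append r r∈N₁)
      (trans (cong (erroneous tr (ℓ₂ U) r ∧_) (sym (colored-at-hit U pre ph tr′ r hit noHitBefore noHitAfter))) e)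

  hit-phase : (U : Tuple m n) → ¬ ℓ₁ U ≡ ℓ₂ U → (pre : Trace m n) (rL : Subset m) (rR : Subset n)
    (c : Fin m) (f : Fin m → Action) (tr′ : Trace m n) →
    Valid (rL ─ removedL f rL c) (rR ─ Nb rR c) tr′ →
    All (λ p → XᵀAt U p ≡ false × XᵀAt (conj U) p ≡ false) pre → Unclustered pre rL →
    XᵀAt U (phase rL rR c f) ≡ true →
    X U (pre ++ phase rL rR c f ∷ tr′) ≡ true × X (conj U) (pre ++ phase rL rR c f ∷ tr′) ≡ false
      × cost U (pre ++ phase rL rR c f ∷ tr′) ℕ.≤ errBoundOf U (f (ℓ₂ U))
  hit-phase U ℓ₁≢ℓ₂ pre rL rR c f tr′ valid noHitBefore unclustered hit = X-U , X-conj-U , cost-bound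
    where
    ph = phase rL rR c f
    c≡ℓ₁ : c ≡ ℓ₁ U
    c≡ℓ₁ = XHolds.centre (X-sound U ph hit)
    later = absentˡ _ _ tr′ (ℓ₁ U) valid
      (subst (λ z → lookup (rL ─ removedL f rL c) z ≡ false) c≡ℓ₁ (centre-removed f rL c))
    noHitAfter : All (λ p → XᵀAt U p ≡ false) tr′
    noHitAfter = All.map (λ {p} → X-off-centre U p ∘ proj₂) later
    noConjAfter : All (λ p → XᵀAt (conj U) p ≡ false) tr′
    noConjAfter = All.map (λ {p} → X-absent (conj U) p ∘ proj₁) later
    neighboursGone : ∀ r → lookup (Nb rR (ℓ₁ U)) r ≡ true → All (λ p → lookup (remR p) r ≡ false) tr′
    neighboursGone r r∈N₁ = absentʳ _ _ tr′ r valid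
      (neighbour-removed rR c r (subst (λ z → lookup (Nb rR z) r ≡ true) (sym c≡ℓ₁) r∈N₁))
    cost-bound = cost-at-hit U ℓ₁≢ℓ₂ pre ph tr′ hit (All.map proj₁ noHitBefore)
      (unclustered (ℓ₂ U) (XHolds.present (X-sound U ph hit))) noHitAfter neighboursGone
    X-U : X U (pre ++ ph ∷ tr′) ≡ true
    X-U = trans (any-++ (XᵀAt U) pre (ph ∷ tr′))
      (trans (cong (λ z → any (XᵀAt U) pre ∨ (z ∨ any (XᵀAt U) tr′)) hit) (∨-zeroʳ _))
    X-conj-U : X (conj U) (pre ++ ph ∷ tr′) ≡ false
    X-conj-U = trans (any-++ (XᵀAt (conj U)) pre (ph ∷ tr′))
      (cong₂ _∨_ (any-none _ pre (All.map proj₂ noHitBefore))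
        (cong₂ _∨_ (X-off-centre (conj U) ph (ℓ₁≢ℓ₂ ∘ trans (sym c≡ℓ₁))) (any-none _ tr′ noConjAfter)))

boolℚ-nonneg : ∀ b → 0ℚ ≤ boolℚ b
boolℚ-nonneg true  = 0≤1
boolℚ-nonneg false = ≤-refl

slack-nonneg : ∀ (x y e₁ e₂ : ℚ) → e₁ + e₂ ≤ x + y → 0ℚ ≤ (x - e₁) + (y - e₂)
slack-nonneg x y e₁ e₂ e≤x = ≤-trans (≤-reflexive (sym (+-inverseʳ (e₁ + e₂))))
  (≤-trans (+-monoˡ-≤ (- (e₁ + e₂)) e≤x) (≤-reflexive
    (solve 4 (λ x y e₁ e₂ → (x :+ y) :- (e₁ :+ e₂) := (x :- e₁) :+ (y :- e₂)) refl x y e₁ e₂)))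

module PairArgument {m n : ℕ} (G : Graph m n) (τ : Tuple m n) (ℓ₁≢ℓ₂ : ¬ ℓ₁ τ ≡ ℓ₂ τ) where
  open Algorithm G
  open Analysis G hiding (count)
  open RunFacts G
  open EventFacts G

  τ̄ : Tuple m n
  τ̄ = conj τ

  firstHit : (Phase m n → ℚ) → (Phase m n → ℚ) → Trace m n → ℚ
  firstHit A B []        = 0ℚ
  firstHit A B (ph ∷ tr) = if XᵀAt τ ph then A ph else (if XᵀAt τ̄ ph then B ph else firstHit A B tr)

  firstHit-τ : ∀ A B ph tr → XᵀAt τ ph ≡ true → firstHit A B (ph ∷ tr) ≡ A ph
  firstHit-τ A B ph tr hit rewrite hit = refl

  firstHit-τ̄ : ∀ A B ph tr → XᵀAt τ ph ≡ false → XᵀAt τ̄ ph ≡ true → firstHit A B (ph ∷ tr) ≡ B ph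
  firstHit-τ̄ A B ph tr no-hit hit rewrite no-hit | hit = refl

  firstHit-skip : ∀ A B ph tr → XᵀAt τ ph ≡ false → XᵀAt τ̄ ph ≡ false → firstHit A B (ph ∷ tr) ≡ firstHit A B tr
  firstHit-skip A B ph tr no-hit no-hit̄ rewrite no-hit | no-hit̄ = refl

  firstHit-split : ∀ (C D A B A′ B′ : Phase m n → ℚ) → (∀ ph → C ph ≡ A ph + A′ ph) → (∀ ph → D ph ≡ B ph + B′ ph) →
    ∀ tr → firstHit C D tr ≡ firstHit A B tr + firstHit A′ B′ tr
  firstHit-split C D A B A′ B′ C≡ D≡ []        = sym (+-identityʳ 0ℚ)
  firstHit-split C D A B A′ B′ C≡ D≡ (ph ∷ tr) with XᵀAt τ ph | XᵀAt τ̄ ph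
  ... | true  | _     = C≡ ph
  ... | false | true  = D≡ ph
  ... | false | false = firstHit-split C D A B A′ B′ C≡ D≡ tr

  firstHit-const : ∀ a b → 0ℚ ≤ a → 0ℚ ≤ b → ∀ tr →
    firstHit (λ _ → a) (λ _ → b) tr ≤ a * boolℚ (X τ tr) + b * boolℚ (X τ̄ tr)
  firstHit-const a b 0≤a 0≤b []        = ≤-reflexive (sym (trans (cong₂ _+_ (*-zeroʳ a) (*-zeroʳ b)) (+-identityʳ 0ℚ)))
  firstHit-const a b 0≤a 0≤b (ph ∷ tr) with XᵀAt τ ph | XᵀAt τ̄ ph
  ... | true  | hit̄  = ≤-trans (≤-reflexive (sym (*-identityʳ a)))
                          (≤-+-nonneg (a * 1ℚ) (*-nonneg 0≤b (boolℚ-nonneg (hit̄ ∨ X τ̄ tr))))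
  ... | false | true  = ≤-trans (≤-reflexive (sym (trans (+-identityˡ (b * 1ℚ)) (*-identityʳ b))))
                          (+-monoˡ-≤ (b * 1ℚ) (*-nonneg 0≤a (boolℚ-nonneg (X τ tr))))
  ... | false | false = firstHit-const a b 0≤a 0≤b tr

  -- The three potentials: the error bound g, the budget 4K = 4 β / q, and the slack 4K − g.
  errAt : Tuple m n → Phase m n → ℚ
  errAt U ph = fromℕ (errBoundOf U (decide ph (ℓ₂ U)))

  budget : Tuple m n → ℚ
  budget U = fromℕ 4 * βRateOf U

  budget-nonneg : ∀ U → 0ℚ ≤ budget U
  budget-nonneg U = *-nonneg {fromℕ 4} {βRateOf U} (fromℕ-nonneg 4) (βRate-nonneg (#R₁₂ U) (#R₁₂ U ℕ.⊓ #R₁ U ℕ.+ #R₁₂ U ℕ.⊓ #R₂ U) (#R₁₂ U ℕ.⊓ #R₂ U))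

  slack : Tuple m n → Phase m n → ℚ
  slack U ph = budget U - errAt U ph

  Φerr Φbudget Φslack : Trace m n → ℚ
  Φerr    = firstHit (errAt τ) (errAt τ̄)
  Φbudget = firstHit (λ _ → budget τ) (λ _ → budget τ̄)
  Φslack  = firstHit (slack τ) (slack τ̄)

  budget-split : ∀ tr → Φbudget tr ≡ Φerr tr + Φslack tr
  budget-split = firstHit-split _ _ (errAt τ) (errAt τ̄) (slack τ) (slack τ̄)
    (λ ph → spend (budget τ) (errAt τ ph)) (λ ph → spend (budget τ̄) (errAt τ̄ ph))
    where
    spend : ∀ x h → x ≡ h + (x - h)
    spend x h = solve 2 (λ x h → x := h :+ (x :- h)) refl x h

  -- Step (1): the charged cost cost(U)·1[X_U] is bounded pointwise by Φerr.
  charged : Tuple m n → Trace m n → ℚ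
  charged U tr = fromℕ (cost U tr) * boolℚ (X U tr)

  charged-hit : ∀ U tr → X U tr ≡ true → X (conj U) tr ≡ false →
    charged U tr + charged (conj U) tr ≡ fromℕ (cost U tr)
  charged-hit U tr hit no-hit̄ = begin
    charged U tr + charged (conj U) tr  ≡⟨ cong₂ (λ a b → C * boolℚ a + C̄ * boolℚ b) hit no-hit̄ ⟩
    C * 1ℚ + C̄ * 0ℚ                    ≡⟨ cong₂ _+_ (*-identityʳ C) (*-zeroʳ C̄) ⟩
    C + 0ℚ                              ≡⟨ +-identityʳ C ⟩
    C                                   ∎
    where
    open ≡-Reasoning
    C = fromℕ (cost U tr)
    C̄ = fromℕ (cost (conj U) tr)

  charged-none : ∀ tr → X τ tr ≡ false → X τ̄ tr ≡ false → charged τ tr + charged τ̄ tr ≡ 0ℚ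
  charged-none tr no-hit no-hit̄ = begin
    charged τ tr + charged τ̄ tr  ≡⟨ cong₂ (λ a b → C * boolℚ a + C̄ * boolℚ b) no-hit no-hit̄ ⟩
    C * 0ℚ + C̄ * 0ℚ             ≡⟨ cong₂ _+_ (*-zeroʳ C) (*-zeroʳ C̄) ⟩
    0ℚ + 0ℚ                      ≡⟨ +-identityʳ 0ℚ ⟩
    0ℚ                           ∎
    where
    open ≡-Reasoning
    C = fromℕ (cost τ tr)
    C̄ = fromℕ (cost τ̄ tr)

  NoHit : Trace m n → Set
  NoHit = All (λ p → XᵀAt τ p ≡ false × XᵀAt τ̄ p ≡ false)

  charged≤Φerr : ∀ tr rL rR pre → Valid rL rR tr → NoHit pre → Unclustered pre rL →
    charged τ (pre ++ tr) + charged τ̄ (pre ++ tr) ≤ Φerr tr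
  charged≤Φerr [] rL rR pre _ noHit _ = ≤-reflexive (trans
    (cong (λ tr → charged τ tr + charged τ̄ tr) (ListP.++-identityʳ pre))
    (charged-none pre (any-none _ pre (All.map proj₁ noHit)) (any-none _ pre (All.map proj₂ noHit))))
  charged≤Φerr (phase .rL .rR c f ∷ tr′) rL rR pre (refl , refl , _ , valid) noHit unclustered =
    bool-cases (XᵀAt τ ph) at-τ λ no-hit → bool-cases (XᵀAt τ̄ ph) (at-τ̄ no-hit) (skip no-hit)
    where
    ph = phase rL rR c f
    tr = pre ++ ph ∷ tr′
    at-τ : XᵀAt τ ph ≡ true → charged τ tr + charged τ̄ tr ≤ Φerr (ph ∷ tr′)
    at-τ hit = begin
      charged τ tr + charged τ̄ tr   ≡⟨ charged-hit τ tr X-τ no-X-τ̄ ⟩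
      fromℕ (cost τ tr)             ≤⟨ fromℕ-mono cost≤ ⟩
      errAt τ ph                    ≡⟨ sym (firstHit-τ (errAt τ) (errAt τ̄) ph tr′ hit) ⟩
      Φerr (ph ∷ tr′)               ∎
      where
      open ≤-Reasoning
      facts = hit-phase τ ℓ₁≢ℓ₂ pre rL rR c f tr′ valid noHit unclustered hit
      X-τ = proj₁ facts
      no-X-τ̄ = proj₁ (proj₂ facts)
      cost≤ = proj₂ (proj₂ facts)
    at-τ̄ : XᵀAt τ ph ≡ false → XᵀAt τ̄ ph ≡ true → charged τ tr + charged τ̄ tr ≤ Φerr (ph ∷ tr′)
    at-τ̄ no-hit hit̄ = begin
      charged τ tr + charged τ̄ tr   ≡⟨ +-comm (charged τ tr) (charged τ̄ tr) ⟩
      charged τ̄ tr + charged τ tr   ≡⟨ charged-hit τ̄ tr X-τ̄ no-X-τ ⟩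
      fromℕ (cost τ̄ tr)             ≤⟨ fromℕ-mono cost≤ ⟩
      errAt τ̄ ph                    ≡⟨ sym (firstHit-τ̄ (errAt τ) (errAt τ̄) ph tr′ no-hit hit̄) ⟩
      Φerr (ph ∷ tr′)               ∎
      where
      open ≤-Reasoning
      facts = hit-phase τ̄ (ℓ₁≢ℓ₂ ∘ sym) pre rL rR c f tr′ valid (All.map Data.Product.swap noHit) unclustered hit̄
      X-τ̄ = proj₁ facts
      no-X-τ = proj₁ (proj₂ facts)
      cost≤ = proj₂ (proj₂ facts)
    skip : XᵀAt τ ph ≡ false → XᵀAt τ̄ ph ≡ false → charged τ tr + charged τ̄ tr ≤ Φerr (ph ∷ tr′)
    skip no-hit no-hit̄ = begin
      charged τ tr + charged τ̄ tr
        ≡⟨ cong (λ tr → charged τ tr + charged τ̄ tr) (sym (ListP.++-assoc pre (ph ∷ []) tr′)) ⟩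
      charged τ ((pre ++ ph ∷ []) ++ tr′) + charged τ̄ ((pre ++ ph ∷ []) ++ tr′)
        ≤⟨ charged≤Φerr tr′ _ _ (pre ++ ph ∷ []) valid (AllP.++⁺ noHit ((no-hit , no-hit̄) ∷ []))
             (Unclustered-step pre rL rR c f unclustered) ⟩
      Φerr tr′
        ≡⟨ sym (firstHit-skip (errAt τ) (errAt τ̄) ph tr′ no-hit no-hit̄) ⟩
      Φerr (ph ∷ tr′) ∎
      where open ≤-Reasoning

  -- Step (2): the expected slack is nonnegative.  One phase of the run is
  -- analysed given the present left nodes x ∷ xs; the rest is the induction
  -- hypothesis IH.
  module SlackStep (k : ℕ) (IH : ∀ rL rR → 0ℚ ≤ 𝔼 (run k rL rR) Φslack)
                   (rL : Subset m) (rR : Subset n) (x : Fin m) (xs : List (Fin m))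
                   (members≡ : members rL ≡ x ∷ xs) where
    ls : List (Fin m)
    ls = x ∷ xs

    slackFrom : Fin m → ℚ
    slackFrom ℓ = 𝔼 (phaseWithCentre k rL rR ls ℓ) Φslack

    -- The phase with centre ℓ; whether X_U happens there does not depend on
    -- the decisions, so they are left out.
    noDecisions : Fin m → Action
    noDecisions _ = nothing

    centredAt : Fin m → Phase m n
    centredAt ℓ = phase rL rR ℓ noDecisions

    hitsAt : Tuple m n → Fin m → Bool
    hitsAt U ℓ = XᵀAt U (centredAt ℓ)

    member : ∀ ℓ → lookup rL ℓ ≡ true → ℓ ∈ ls
    member ℓ ℓ∈ = subst (ℓ ∈_) members≡ (MemP.∈-filter⁺ (T? ∘ lookup rL) (MemP.∈-allFin ℓ) (≡→T ℓ∈))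

    present : ∀ ℓ → ℓ ∈ ls → lookup rL ℓ ≡ true
    present ℓ ℓ∈ = T→≡ (proj₂ (MemP.∈-filter⁻ (T? ∘ lookup rL) {xs = allFin m} (subst (ℓ ∈_) (sym members≡) ℓ∈)))

    ls-unique : Unique ls
    ls-unique = subst Unique members≡ (UniqueP.filter⁺ (T? ∘ lookup rL) (UniqueP.allFin⁺ m))

    rest : Fin m → (Fin m → Action) → Dist (Trace m n)
    rest ℓ f = run k (rL ─ removedL f rL ℓ) (rR ─ Nb rR ℓ)

    slackFrom-eq : ∀ ℓ → slackFrom ℓ ≡
      𝔼 (decisions rR ℓ (others ls ℓ)) (λ f → 𝔼 (rest ℓ f) (λ tr → Φslack (phase rL rR ℓ f ∷ tr)))
    slackFrom-eq ℓ = trans (𝔼-bind (decisions rR ℓ (others ls ℓ)) (afterDecisions k rL rR ℓ) Φslack)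
      (𝔼-cong (decisions rR ℓ (others ls ℓ)) λ f →
        trans (𝔼-bind (rest ℓ f) (λ tr → return (phase rL rR ℓ f ∷ tr)) Φslack)
          (𝔼-cong (rest ℓ f) λ tr → 𝔼-return (phase rL rR ℓ f ∷ tr) Φslack))

    quiet : ∀ ℓ → hitsAt τ ℓ ≡ false → hitsAt τ̄ ℓ ≡ false → 0ℚ ≤ slackFrom ℓ
    quiet ℓ no-hit no-hit̄ = ≤-trans
      (𝔼-nonneg (decisions rR ℓ (others ls ℓ)) (Supported-decisions rR ℓ (others ls ℓ)) λ f _ →
        ≤-trans (IH (rL ─ removedL f rL ℓ) (rR ─ Nb rR ℓ)) (≤-reflexive (𝔼-cong (rest ℓ f) λ tr →
          sym (firstHit-skip (slack τ) (slack τ̄) (phase rL rR ℓ f) tr no-hit no-hit̄))))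
      (≤-reflexive (sym (slackFrom-eq ℓ)))

    slack-at-hit : (U : Tuple m n) → ℓ₂ U ∈ ls → ¬ ℓ₂ U ≡ ℓ₁ U → hitsAt U (ℓ₁ U) ≡ true →
      (∀ f tr → Φslack (phase rL rR (ℓ₁ U) f ∷ tr) ≡ slack U (phase rL rR (ℓ₁ U) f)) →
      slackFrom (ℓ₁ U) ≡ budget U - expectedErr (#R₁ U) (#R₂ U) (#R₁₂ U)
    slack-at-hit U ℓ₂∈ ℓ₂≢ℓ₁ hit Φslack-at = begin
      slackFrom (ℓ₁ U)
        ≡⟨ slackFrom-eq (ℓ₁ U) ⟩
      𝔼 decs (λ f → 𝔼 (rest (ℓ₁ U) f) (λ tr → Φslack (phase rL rR (ℓ₁ U) f ∷ tr)))
        ≡⟨ 𝔼-cong decs (λ f → trans (𝔼-cong (rest (ℓ₁ U) f) (Φslack-at f))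
             (𝔼-const (rest (ℓ₁ U) f) (slack U (phase rL rR (ℓ₁ U) f))
               (Mass1-run k (rL ─ removedL f rL (ℓ₁ U)) (rR ─ Nb rR (ℓ₁ U))))) ⟩
      𝔼 decs (λ f → budget U - fromℕ (errBoundOf U (f (ℓ₂ U))))
        ≡⟨ 𝔼-const-sub decs (budget U) (λ f → fromℕ (errBoundOf U (f (ℓ₂ U)))) (Mass1-decisions rR (ℓ₁ U) (others ls (ℓ₁ U))) ⟩
      budget U - 𝔼 decs (λ f → fromℕ (errBoundOf U (f (ℓ₂ U))))
        ≡⟨ cong (λ e → budget U - e) (𝔼-decisions-at rR (ℓ₁ U) (others ls (ℓ₁ U)) (ℓ₂ U) (fromℕ ∘ errBoundOf U) ℓ₂∈others) ⟩
      budget U - 𝔼 (decision rR (ℓ₁ U) (ℓ₂ U)) (fromℕ ∘ errBoundOf U)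
        ≡⟨ cong (λ d → budget U - 𝔼 d (fromℕ ∘ errBoundOf U)) (decision-at-X U (centredAt (ℓ₁ U)) hit) ⟩
      budget U - expectedErr (#R₁ U) (#R₂ U) (#R₁₂ U) ∎
      where
      open ≡-Reasoning
      decs = decisions rR (ℓ₁ U) (others ls (ℓ₁ U))
      ℓ₂∈others : ℓ₂ U ∈ others ls (ℓ₁ U)
      ℓ₂∈others = MemP.∈-filter⁺ (T? ∘ λ y → not (does (y ≟ ℓ₁ U))) ℓ₂∈
        (subst (T ∘ not) (sym (does-false ℓ₂≢ℓ₁)) tt)

    -- If both ℓ₁ and ℓ₂ are present, X_τ at centre ℓ₁ and X_τ̄ at centre ℓ₂
    -- happen together, and then the pair inequality pays for both.
    both-present : ℓ₁ τ ∈ ls → ℓ₂ τ ∈ ls → 0ℚ ≤ slackFrom (ℓ₁ τ) + slackFrom (ℓ₂ τ)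
    both-present ℓ₁∈ ℓ₂∈ = bool-cases (hitsAt τ (ℓ₁ τ)) hit-pair λ no-hit →
      bool-cases (hitsAt τ̄ (ℓ₂ τ))
        (λ hit̄ → ⊥-elim (true≢false (trans (sym (X-conj τ̄ rL rR noDecisions noDecisions hit̄ (present (ℓ₂ τ) ℓ₂∈))) no-hit)))
        (λ no-hit̄ → +-nonneg (quiet (ℓ₁ τ) no-hit (X-off-centre τ̄ (centredAt (ℓ₁ τ)) ℓ₁≢ℓ₂))
                             (quiet (ℓ₂ τ) (X-off-centre τ (centredAt (ℓ₂ τ)) (ℓ₁≢ℓ₂ ∘ sym)) no-hit̄))
      where
      true≢false : ¬ true ≡ false
      true≢false ()
      hit-pair : hitsAt τ (ℓ₁ τ) ≡ true → 0ℚ ≤ slackFrom (ℓ₁ τ) + slackFrom (ℓ₂ τ)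
      hit-pair hit = subst (0ℚ ≤_)
        (sym (cong₂ _+_
          (slack-at-hit τ ℓ₂∈ (ℓ₁≢ℓ₂ ∘ sym) hit λ f tr → firstHit-τ (slack τ) (slack τ̄) (phase rL rR (ℓ₁ τ) f) tr hit)
          (slack-at-hit τ̄ ℓ₁∈ ℓ₁≢ℓ₂ hit̄ λ f tr →
            firstHit-τ̄ (slack τ) (slack τ̄) (phase rL rR (ℓ₂ τ) f) tr
              (X-off-centre τ (phase rL rR (ℓ₂ τ) f) (ℓ₁≢ℓ₂ ∘ sym)) hit̄)))
        (slack-nonneg (budget τ) (budget τ̄) (expectedErr (#R₁ τ) (#R₂ τ) (#R₁₂ τ))
          (expectedErr (#R₁ τ̄) (#R₂ τ̄) (#R₁₂ τ̄))
          (≤-trans (pairBound (#R₁ τ) (#R₂ τ) (#R₁₂ τ)) (≤-reflexive (*-distribˡ-+ (fromℕ 4) (βRateOf τ) (βRateOf τ̄)))))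
        where
        hit̄ : hitsAt τ̄ (ℓ₂ τ) ≡ true
        hit̄ = X-conj τ rL rR noDecisions noDecisions hit (present (ℓ₁ τ) ℓ₁∈)

    -- If only one of ℓ₁, ℓ₂ is present, no hit is possible.
    only-ℓ₁ : ℓ₁ τ ∈ ls → ℓ₂ τ ∉ ls → 0ℚ ≤ slackFrom (ℓ₁ τ)
    only-ℓ₁ _ ℓ₂∉ = bool-cases (hitsAt τ (ℓ₁ τ))
      (λ hit → ⊥-elim (ℓ₂∉ (member (ℓ₂ τ) (XHolds.present (X-sound τ (centredAt (ℓ₁ τ)) hit)))))
      (λ no-hit → quiet (ℓ₁ τ) no-hit (X-off-centre τ̄ (centredAt (ℓ₁ τ)) ℓ₁≢ℓ₂))

    only-ℓ₂ : ℓ₂ τ ∈ ls → ℓ₁ τ ∉ ls → 0ℚ ≤ slackFrom (ℓ₂ τ)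
    only-ℓ₂ _ ℓ₁∉ = bool-cases (hitsAt τ̄ (ℓ₂ τ))
      (λ hit̄ → ⊥-elim (ℓ₁∉ (member (ℓ₁ τ) (XHolds.present (X-sound τ̄ (centredAt (ℓ₂ τ)) hit̄)))))
      (λ no-hit̄ → quiet (ℓ₂ τ) (X-off-centre τ (centredAt (ℓ₂ τ)) (ℓ₁≢ℓ₂ ∘ sym)) no-hit̄)

    slack-step : 0ℚ ≤ 𝔼 (uniform ls >>= phaseWithCentre k rL rR ls) Φslack
    slack-step = ≤-trans
      (*-nonneg (frac-nonneg 1 (suc (length xs)))
        (sumℚ-nonneg-pair _≟_ slackFrom ls (ℓ₁ τ) (ℓ₂ τ) ls-unique ℓ₁≢ℓ₂
          (λ ℓ _ ℓ≢ℓ₁ ℓ≢ℓ₂ → quiet ℓ (X-off-centre τ (centredAt ℓ) ℓ≢ℓ₁) (X-off-centre τ̄ (centredAt ℓ) ℓ≢ℓ₂))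
          both-present only-ℓ₁ only-ℓ₂))
      (≤-reflexive (sym (trans (𝔼-bind (uniform ls) (phaseWithCentre k rL rR ls) Φslack)
        (𝔼-equalWeights (frac 1 (suc (length xs))) ls slackFrom))))

  Φslack-nonneg : ∀ k rL rR → 0ℚ ≤ 𝔼 (run k rL rR) Φslack
  Φslack-nonneg zero    rL rR = ≤-reflexive (sym (𝔼-return [] Φslack))
  Φslack-nonneg (suc k) rL rR with members rL in members≡
  ... | []     = ≤-reflexive (sym (𝔼-return [] Φslack))
  ... | x ∷ xs = SlackStep.slack-step k (Φslack-nonneg k) rL rR x xs members≡

  -- Step (3): β(U) = (β(U) / q(U)) · q(U), which identifies the budget.
  α≡αRatio : ∀ U → α U ≡ αRatio (#R₁₂ U) (#R₁₂ U ℕ.⊓ #R₁ U ℕ.+ #R₁₂ U ℕ.⊓ #R₂ U)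
  α≡αRatio U with #R₁₂ U ℕ.⊓ #R₁ U ℕ.+ #R₁₂ U ℕ.⊓ #R₂ U
  ... | zero  = refl
  ... | suc _ = refl

  β≡βRate*q : ∀ U → β U ≡ βRateOf U * q U
  β≡βRate*q U with ∣ R₁₂ U ∣ in c≡
  ... | zero  = sym (*-zeroˡ (q U))
  ... | suc c = begin
    α U * q U * fromℕ (#R₁₂ U ℕ.⊓ #R₂ U)
      ≡⟨ cong (λ a → a * q U * fromℕ (#R₁₂ U ℕ.⊓ #R₂ U)) (α≡αRatio U) ⟩
    αRatio (#R₁₂ U) s * q U * fromℕ (#R₁₂ U ℕ.⊓ #R₂ U)
      ≡⟨ solve 3 (λ a q k → a :* q :* k := a :* k :* q) refl (αRatio (#R₁₂ U) s) (q U) (fromℕ (#R₁₂ U ℕ.⊓ #R₂ U)) ⟩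
    αRatio (#R₁₂ U) s * fromℕ (#R₁₂ U ℕ.⊓ #R₂ U) * q U
      ≡⟨ cong (λ c → αRatio c (c ℕ.⊓ #R₁ U ℕ.+ c ℕ.⊓ #R₂ U) * fromℕ (c ℕ.⊓ #R₂ U) * q U) c≡ ⟩
    αRatio (suc c) (suc c ℕ.⊓ #R₁ U ℕ.+ suc c ℕ.⊓ #R₂ U) * fromℕ (suc c ℕ.⊓ #R₂ U) * q U ∎
    where
    open ≡-Reasoning
    s = #R₁₂ U ℕ.⊓ #R₁ U ℕ.+ #R₁₂ U ℕ.⊓ #R₂ U

lemma3 : {m n : ℕ} (G : Graph m n) (T : Tuple m n) → IsTuple G T →
    Analysis.qE G T + Analysis.qE G (conj T)
    ≤ (+ 4 / 1) * (Analysis.β G T + Analysis.β G (conj T))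
lemma3 {m} G T (ℓ₁≢ℓ₂ , _) = begin
  qE T + qE τ̄
    ≡⟨ sym (𝔼-+ D (charged T) (charged τ̄)) ⟩
  𝔼 D (λ tr → charged T tr + charged τ̄ tr)
    ≤⟨ 𝔼-mono D (Supported-run m ⊤ ⊤) (λ tr valid → charged≤Φerr tr ⊤ ⊤ [] valid [] λ _ _ _ → refl) ⟩
  𝔼 D Φerr
    ≤⟨ ≤-+-nonneg (𝔼 D Φerr) (Φslack-nonneg m ⊤ ⊤) ⟩
  𝔼 D Φerr + 𝔼 D Φslack
    ≡⟨ sym (trans (𝔼-cong D budget-split) (𝔼-+ D Φerr Φslack)) ⟩
  𝔼 D Φbudget
    ≤⟨ 𝔼-mono D (Supported-run m ⊤ ⊤) (λ tr _ → firstHit-const (budget T) (budget τ̄) (budget-nonneg T) (budget-nonneg τ̄) tr) ⟩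
  𝔼 D (λ tr → budget T * boolℚ (X T tr) + budget τ̄ * boolℚ (X τ̄ tr))
    ≡⟨ trans (𝔼-+ D (λ tr → budget T * boolℚ (X T tr)) (λ tr → budget τ̄ * boolℚ (X τ̄ tr)))
         (cong₂ _+_ (𝔼-*ˡ D (budget T) (boolℚ ∘ X T)) (𝔼-*ˡ D (budget τ̄) (boolℚ ∘ X τ̄))) ⟩
  budget T * q T + budget τ̄ * q τ̄
    ≡⟨ solve 5 (λ f k q k̄ q̄ → f :* k :* q :+ f :* k̄ :* q̄ := f :* (k :* q :+ k̄ :* q̄))
         refl (fromℕ 4) (βRateOf T) (q T) (βRateOf τ̄) (q τ̄) ⟩
  fromℕ 4 * (βRateOf T * q T + βRateOf τ̄ * q τ̄)
    ≡⟨ cong (fromℕ 4 *_) (sym (cong₂ _+_ (β≡βRate*q T) (β≡βRate*q τ̄))) ⟩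
  fromℕ 4 * (β T + β τ̄) ∎
  where
  open ≤-Reasoning
  open Algorithm G using (pivotBiCluster)
  open Analysis G using (qE; q; β; X)
  open RunFacts G using (Supported-run)
  open PairArgument G T ℓ₁≢ℓ₂
  D = pivotBiCluster
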